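{- Suppose the EEC computation type $\underline R$ is either a computation-type constant or $\underline I$. Then, for every value type $A$, the closed term $\theta_A:A^{\bullet\bullet}\to A$ is (well defined and) an isomorphism, and for every computation type $\underline A$, the closed term $\underline\theta_{\underline A}:\underline A^{\circ\circ}\multimap\underline A$ is (well defined and) a linear isomorphism.
   Context: **EEC (enriched effect calculus).** There are value-type constants $\alpha,\beta,\ldots$ and a disjoint set of computation-type constants $\underline{\alpha},\underline{\beta},\ldots$. Value types $A,B,C$ and computation types $\underline{A},\underline{B},\underline{C},\underline{D}$ are generated by $A::=\alpha\mid 1\mid A\times B\mid A\to B\mid \underline{A}\mid \underline{A}\multimap\underline{B}$ and $\underline{A}::=\underline{\alpha}\mid\underline{1}\mid\underline{A}\,\&\,\underline{B}\mid A\Rightarrow\underline{B}\mid\underline{I}\mid\ !A\mid\ !A\otimes\underline{B}\mid\underline{0}\mid\underline{A}\oplus\underline{B}$ (every computation type is also a value type; $!A\otimes\underline{B}$ is one primitive binary constructor). Judgements are $\Gamma\mid -\vdash t:A$ and $\Gamma\mid z{:}\underline{A}\vdash t:\underline{B}$, where $\Gamma$ lists distinct variables with value types and the "stoup" holds at most one variable, of computation type; with nonempty stoup the result type is a computation type. Below $\Delta$ is empty or $z{:}\underline{D}$. Typing rules: $\Gamma,x{:}A\mid-\vdash x:A$; $\Gamma\mid-\vdash *:1$; pairs $\langle t,u\rangle:A\times B$, projections $\pi_1t,\pi_2t$; $\lambda x{:}A.t:A\to B$ from $\Gamma,x{:}A\mid-\vdash t:B$; application $t\,u$ (all with empty stoup).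 $\Gamma\mid z{:}\underline A\vdash z:\underline A$; $\Gamma\mid\Delta\vdash\underline{*}:\underline 1$; from $\Gamma\mid\Delta\vdash t:\underline A$, $\Gamma\mid\Delta\vdash u:\underline B$ get $\Gamma\mid\Delta\vdash\langle t,u\rangle_c:\underline A\,\&\,\underline B$, and from $\Gamma\mid\Delta\vdash t:\underline A\,\&\,\underline B$ get $\underline\pi_1t:\underline A$, $\underline\pi_2t:\underline B$; from $\Gamma,x{:}A\mid\Delta\vdash t:\underline B$ get $\Gamma\mid\Delta\vdash\underline\lambda x{:}A.t:A\Rightarrow\underline B$; from $\Gamma\mid\Delta\vdash s:A\Rightarrow\underline B$, $\Gamma\mid-\vdash t:A$ get $\Gamma\mid\Delta\vdash s@t:\underline B$; $\Gamma\mid-\vdash\top:\underline I$; from $\Gamma\mid\Delta\vdash t:\underline I$, $\Gamma\mid-\vdash u:\underline A$ get $\Gamma\mid\Delta\vdash \mathrm{let}\ \top\ \mathrm{be}\ t\ \mathrm{in}\ u:\underline A$; from $\Gamma\mid-\vdash t:A$ get $\Gamma\mid-\vdash\,!t:\,!A$; from $\Gamma\mid\Delta\vdash t:\,!A$, $\Gamma,x{:}A\mid-\vdash u:\underline B$ get $\Gamma\mid\Delta\vdash\mathrm{let}\ !x\ \mathrm{be}\ t\ \mathrm{in}\ u:\underline B$; from $\Gamma\mid-\vdash t:A$, $\Gamma\mid\Delta\vdash u:\underline B$ get $\Gamma\mid\Delta\vdash\,!t\otimes u:\,!A\otimes\underline B$; from $\Gamma\mid\Delta\vdash s:\,!A\otimes\underline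 B$, $\Gamma,x{:}A\mid y{:}\underline B\vdash t:\underline C$ get $\Gamma\mid\Delta\vdash\mathrm{let}\ !x\otimes y\ \mathrm{be}\ s\ \mathrm{in}\ t:\underline C$; from $\Gamma\mid\Delta\vdash t:\underline 0$ get $\Gamma\mid\Delta\vdash\mathrm{abort}_{\underline A}(t):\underline A$; $\mathrm{inl}\,t:\underline A\oplus\underline B$ from $t:\underline A$ and $\mathrm{inr}\,t$ from $t:\underline B$ (same $\Gamma\mid\Delta$); from $\Gamma\mid\Delta\vdash s:\underline A\oplus\underline B$, $\Gamma\mid x{:}\underline A\vdash t:\underline C$, $\Gamma\mid y{:}\underline B\vdash u:\underline C$ get $\Gamma\mid\Delta\vdash\mathrm{case}\ s\ \mathrm{of}\ (\mathrm{inl}\,x\Rightarrow t\mid\mathrm{inr}\,y\Rightarrow u):\underline C$; from $\Gamma\mid z{:}\underline A\vdash t:\underline B$ get $\Gamma\mid-\vdash\hat\lambda z{:}\underline A.t:\underline A\multimap\underline B$; from $\Gamma\mid-\vdash s:\underline A\multimap\underline B$, $\Gamma\mid\Delta\vdash t:\underline A$ get $\Gamma\mid\Delta\vdash s\{t\}:\underline B$. Equality $\Gamma\mid\Delta\vdash t=u:A$ is the least typed congruence (equivalence, compatible with all term formers, containing $\alpha$-equivalence) containing all well-typed instances of: $t=*$ for $t:1$; $\pi_1\langle t,u\rangle=t$, $\pi_2\langle t,u\rangle=u$, $\langle\pi_1t,\pi_2t\rangle=t$; $(\lambda x.t)u=t[u/x]$, $\lambda x.(t\,x)=t$ ($x$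 not free in $t$); $t=\underline*$ for $t:\underline1$; $\underline\pi_1\langle t,u\rangle_c=t$, $\underline\pi_2\langle t,u\rangle_c=u$, $\langle\underline\pi_1t,\underline\pi_2t\rangle_c=t$; $(\underline\lambda x.t)@u=t[u/x]$, $\underline\lambda x.(t@x)=t$ ($x$ not free); $\mathrm{let}\ \top\ \mathrm{be}\ \top\ \mathrm{in}\ t=t$; $\mathrm{let}\ \top\ \mathrm{be}\ t\ \mathrm{in}\ u[\top/x]=u[t/x]$ for $\Gamma\mid x{:}\underline I\vdash u:\underline A$; $\mathrm{let}\ !x\ \mathrm{be}\ !t\ \mathrm{in}\ u=u[t/x]$; $\mathrm{let}\ !x\ \mathrm{be}\ t\ \mathrm{in}\ u[!x/y]=u[t/y]$ for $\Gamma\mid y{:}\,!A\vdash u:\underline B$; $\mathrm{let}\ !x\otimes y\ \mathrm{be}\ !t\otimes s\ \mathrm{in}\ u=u[t/x,s/y]$; $\mathrm{let}\ !x\otimes y\ \mathrm{be}\ t\ \mathrm{in}\ u[(!x\otimes y)/z]=u[t/z]$ for $\Gamma\mid z{:}\,!A\otimes\underline B\vdash u:\underline C$; $\mathrm{abort}_{\underline A}(t)=u[t/x]$ for $\Gamma\mid x{:}\underline 0\vdash u:\underline A$; $\mathrm{case}\ \mathrm{inl}\,t\ \mathrm{of}\ (\mathrm{inl}\,x\Rightarrow u\mid\mathrm{inr}\,y\Rightarrow u')=u[t/x]$ and symmetrically for $\mathrm{inr}$; $\mathrm{case}\ t\ \mathrm{of}\ (\mathrm{inl}\,x\Rightarrow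 u[\mathrm{inl}\,x/z]\mid\mathrm{inr}\,y\Rightarrow u[\mathrm{inr}\,y/z])=u[t/z]$ for $\Gamma\mid z{:}\underline A\oplus\underline B\vdash u:\underline C$; $(\hat\lambda x.t)\{u\}=t[u/x]$, $\hat\lambda x.(t\{x\})=t$ ($x$ not free). **Type translation relative to $\underline R$.** $\alpha^\bullet=\alpha$, $1^\bullet=1$, $(A\times B)^\bullet=A^\bullet\times B^\bullet$, $(A\to B)^\bullet=A^\bullet\to B^\bullet$, $\underline A^\bullet=\underline A^\circ\multimap\underline R$ (a computation type viewed as a value type), $(\underline A\multimap\underline B)^\bullet=\underline B^\circ\multimap\underline A^\circ$; $\underline\alpha^\circ=\underline\alpha$ if $\underline\alpha\neq\underline R$ and $\underline\alpha^\circ=\underline I$ if $\underline R$ is the constant $\underline\alpha$; $\underline1^\circ=\underline0$; $(\underline A\,\&\,\underline B)^\circ=\underline A^\circ\oplus\underline B^\circ$; $(A\Rightarrow\underline B)^\circ=\,!(A^\bullet)\otimes\underline B^\circ$; $\underline I^\circ=\underline R$; $(!A)^\circ=A^\bullet\Rightarrow\underline R$; $(!A\otimes\underline B)^\circ=A^\bullet\Rightarrow\underline B^\circ$; $\underline0^\circ=\underline1$; $(\underline A\oplus\underline B)^\circ=\underline A^\circ\,\&\,\underline B^\circ$. ($A^{\bullet\bullet}=(A^\bullet)^\bullet$, $\underline A^{\circ\circ}=(\underline A^\circ)^\circ$.) **Isomorphisms.** A closed term $f:A\to B$ is an isomorphism if there is a closed $g:B\to A$ with $\lambda x{:}A.\,g(f\,x)=\lambda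 x{:}A.\,x$ and $\lambda y{:}B.\,f(g\,y)=\lambda y{:}B.\,y$ (such $g$, written $f^{ -1}$, is unique up to provable equality); a closed $f:\underline A\multimap\underline B$ is a linear isomorphism if there is a closed $g:\underline B\multimap\underline A$ with $\hat\lambda x{:}\underline A.\,g\{f\{x\}\}=\hat\lambda x{:}\underline A.\,x$ and $\hat\lambda y{:}\underline B.\,f\{g\{y\}\}=\hat\lambda y{:}\underline B.\,y$. The terms $\theta_A$ and $\underline\theta_{\underline A}$ are defined by simultaneous induction on types (for a computation type, $\underline\theta_{\underline A}$ before $\theta_{\underline A}$), the clauses for function types using inverses $\theta^{ -1}$, $\underline\theta^{ -1}$ at smaller types: $\theta_\alpha=\lambda x{:}\alpha.x$; $\theta_1=\lambda x{:}1.*$; $\theta_{A\times B}=\lambda z{:}A^{\bullet\bullet}\times B^{\bullet\bullet}.\langle\theta_A(\pi_1z),\theta_B(\pi_2z)\rangle$; $\theta_{A\to B}=\lambda f{:}A^{\bullet\bullet}\to B^{\bullet\bullet}.\lambda x{:}A.\,\theta_B(f(\theta_A^{ -1}x))$; $\theta_{\underline A}=\lambda h{:}\underline I\multimap\underline A^{\circ\circ}.\,\underline\theta_{\underline A}\{h\{\top\}\}$; $\theta_{\underline A\multimap\underline B}=\lambda h{:}\underline A^{\circ\circ}\multimap\underline B^{\circ\circ}.\,\hat\lambda x{:}\underline A.\,\underline\theta_{\underline B}\{h\{\underline\theta_{\underline A}^{ -1}\{x\}\}\}$; $\underline\theta_{\underline\alpha}=\hat\lambda z{:}\underline\alpha.z$;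 $\underline\theta_{\underline1}=\hat\lambda z{:}\underline1.\underline*$; $\underline\theta_{\underline A\&\underline B}=\hat\lambda z{:}\underline A^{\circ\circ}\,\&\,\underline B^{\circ\circ}.\langle\underline\theta_{\underline A}\{\underline\pi_1z\},\underline\theta_{\underline B}\{\underline\pi_2z\}\rangle_c$; $\underline\theta_{A\Rightarrow\underline B}=\hat\lambda f{:}A^{\bullet\bullet}\Rightarrow\underline B^{\circ\circ}.\,\underline\lambda x{:}A.\,\underline\theta_{\underline B}\{f@(\theta_A^{ -1}x)\}$; $\underline\theta_{\underline I}=\hat\lambda z{:}\underline I.z$; $\underline\theta_{!A}=\hat\lambda z{:}\,!(A^{\bullet\bullet})\otimes\underline I.\,\mathrm{let}\ !x\otimes y\ \mathrm{be}\ z\ \mathrm{in}\ \mathrm{let}\ \top\ \mathrm{be}\ y\ \mathrm{in}\ !(\theta_Ax)$; $\underline\theta_{!A\otimes\underline B}=\hat\lambda z{:}\,!(A^{\bullet\bullet})\otimes\underline B^{\circ\circ}.\,\mathrm{let}\ !x\otimes y\ \mathrm{be}\ z\ \mathrm{in}\ !(\theta_Ax)\otimes(\underline\theta_{\underline B}\{y\})$; $\underline\theta_{\underline0}=\hat\lambda z{:}\underline0.z$; $\underline\theta_{\underline A\oplus\underline B}=\hat\lambda z{:}\underline A^{\circ\circ}\oplus\underline B^{\circ\circ}.\,\mathrm{case}\ z\ \mathrm{of}\ (\mathrm{inl}\,x\Rightarrow\mathrm{inl}(\underline\theta_{\underline A}\{x\})\mid\mathrm{inr}\,y\Rightarrow\mathrm{inr}(\underline\theta_{\underline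 B}\{y\}))$. -}

module Defs where

open import Data.Nat using (ℕ; zero; suc; _≟_)
open import Data.Bool using (Bool; true; false; if_then_else_)
open import Data.List using (List; []; _∷_)
open import Data.Maybe using (Maybe; just; nothing)
open import Relation.Nullary using (does)
open import Relation.Binary.PropositionalEquality using (_≡_)

infixr 30 _⇒_ _⇛_
infixr 31 _⊸_
infixr 35 _×ᵗ_ _&_ _⊕_ _!⊗_
infix  40 !_

mutual
  data VTy : Set where
    vconst : ℕ → VTy
    𝟙      : VTy
    _×ᵗ_   : VTy → VTy → VTy
    _⇒_    : VTy → VTy → VTy
    ⌞_⌟    : CTy → VTy               -- a computation type viewed as a value type
    _⊸_    : CTy → CTy → VTy

  data CTy : Set where
    cconst : ℕ → CTy
    𝟙ᶜ     : CTy
    _&_    : CTy → CTy → CTy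
    _⇛_    : VTy → CTy → CTy
    Iᶜ     : CTy
    !_     : VTy → CTy
    _!⊗_   : VTy → CTy → CTy         -- !A ⊗ B̲  (one primitive binary constructor)
    𝟘ᶜ     : CTy
    _⊕_    : CTy → CTy → CTy

isConst : CTy → ℕ → Bool
isConst (cconst n) m = does (m ≟ n)
isConst _          m = false

module Translation (R : CTy) where
  infix 50 _• _°
  mutual
    _• : VTy → VTy
    vconst n • = vconst n
    𝟙 •        = 𝟙
    (A ×ᵗ B) • = (A •) ×ᵗ (B •)
    (A ⇒ B) •  = (A •) ⇒ (B •)
    ⌞ C ⌟ •    = (C °) ⊸ R
    (A ⊸ B) •  = (B °) ⊸ (A °)

    _° : CTy → CTy
    cconst n ° = if isConst R n then Iᶜ else cconst n
    𝟙ᶜ °       = 𝟘ᶜ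
    (A & B) °  = (A °) ⊕ (B °)
    (A ⇛ B) °  = (A •) !⊗ (B °)
    Iᶜ °       = R
    (! A) °    = (A •) ⇛ R
    (A !⊗ B) ° = (A •) ⇛ (B °)
    𝟘ᶜ °       = 𝟙ᶜ
    (A ⊕ B) °  = (A °) & (B °)

-- Raw terms, de Bruijn for context (value) variables.  The stoup holds at
-- most one variable, written  svar.  Binders:
--   context binders: lam (body), clam (body), letBang (2nd), letTens (2nd)
--   stoup binders:   letTens (2nd, binds y), case (both branches), llam (body)

data Tm : Set where
  var     : ℕ → Tm
  star    : Tm
  pair    : Tm → Tm → Tm
  fst snd : Tm → Tm
  lam     : VTy → Tm → Tm
  app     : Tm → Tm → Tm
  svar    : Tm
  cstar   : Tm
  cpair   : Tm → Tm → Tm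
  cfst csnd : Tm → Tm
  clam    : VTy → Tm → Tm
  capp    : Tm → Tm → Tm
  top     : Tm
  letTop  : Tm → Tm → Tm
  bang    : Tm → Tm
  letBang : Tm → Tm → Tm
  tens    : Tm → Tm → Tm
  letTens : Tm → Tm → Tm
  abort   : CTy → Tm → Tm
  inl inr : Tm → Tm
  case    : Tm → Tm → Tm → Tm
  llam    : CTy → Tm → Tm
  lapp    : Tm → Tm → Tm

ext : (ℕ → ℕ) → ℕ → ℕ
ext ρ zero    = zero
ext ρ (suc n) = suc (ρ n)

ren : (ℕ → ℕ) → Tm → Tm
ren ρ (var n)       = var (ρ n)
ren ρ star          = star
ren ρ (pair t u)    = pair (ren ρ t) (ren ρ u)
ren ρ (fst t)       = fst (ren ρ t)
ren ρ (snd t)       = snd (ren ρ t)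
ren ρ (lam A t)     = lam A (ren (ext ρ) t)
ren ρ (app t u)     = app (ren ρ t) (ren ρ u)
ren ρ svar          = svar
ren ρ cstar         = cstar
ren ρ (cpair t u)   = cpair (ren ρ t) (ren ρ u)
ren ρ (cfst t)      = cfst (ren ρ t)
ren ρ (csnd t)      = csnd (ren ρ t)
ren ρ (clam A t)    = clam A (ren (ext ρ) t)
ren ρ (capp t u)    = capp (ren ρ t) (ren ρ u)
ren ρ top           = top
ren ρ (letTop t u)  = letTop (ren ρ t) (ren ρ u)
ren ρ (bang t)      = bang (ren ρ t)
ren ρ (letBang t u) = letBang (ren ρ t) (ren (ext ρ) u)
ren ρ (tens t u)    = tens (ren ρ t) (ren ρ u)
ren ρ (letTens t u) = letTens (ren ρ t) (ren (ext ρ) u)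
ren ρ (abort A t)   = abort A (ren ρ t)
ren ρ (inl t)       = inl (ren ρ t)
ren ρ (inr t)       = inr (ren ρ t)
ren ρ (case s t u)  = case (ren ρ s) (ren ρ t) (ren ρ u)
ren ρ (llam A t)    = llam A (ren ρ t)
ren ρ (lapp t u)    = lapp (ren ρ t) (ren ρ u)

shift : Tm → Tm
shift = ren suc

exts : (ℕ → Tm) → ℕ → Tm
exts σ zero    = var zero
exts σ (suc n) = shift (σ n)

sub : (ℕ → Tm) → Tm → Tm
sub σ (var n)       = σ n
sub σ star          = star
sub σ (pair t u)    = pair (sub σ t) (sub σ u)
sub σ (fst t)       = fst (sub σ t)
sub σ (snd t)       = snd (sub σ t)
sub σ (lam A t)     = lam A (sub (exts σ) t)
sub σ (app t u)     = app (sub σ t) (sub σ u)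
sub σ svar          = svar
sub σ cstar         = cstar
sub σ (cpair t u)   = cpair (sub σ t) (sub σ u)
sub σ (cfst t)      = cfst (sub σ t)
sub σ (csnd t)      = csnd (sub σ t)
sub σ (clam A t)    = clam A (sub (exts σ) t)
sub σ (capp t u)    = capp (sub σ t) (sub σ u)
sub σ top           = top
sub σ (letTop t u)  = letTop (sub σ t) (sub σ u)
sub σ (bang t)      = bang (sub σ t)
sub σ (letBang t u) = letBang (sub σ t) (sub (exts σ) u)
sub σ (tens t u)    = tens (sub σ t) (sub σ u)
sub σ (letTens t u) = letTens (sub σ t) (sub (exts σ) u)
sub σ (abort A t)   = abort A (sub σ t)
sub σ (inl t)       = inl (sub σ t)
sub σ (inr t)       = inr (sub σ t)
sub σ (case s t u)  = case (sub σ s) (sub σ t) (sub σ u)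
sub σ (llam A t)    = llam A (sub σ t)
sub σ (lapp t u)    = lapp (sub σ t) (sub σ u)

single : Tm → ℕ → Tm
single u zero    = u
single u (suc n) = var n

sub1 : Tm → Tm → Tm
sub1 u t = sub (single u) t

-- t [ u / z ]  where z is the stoup variable (stoup binders shadow it)
ssub : Tm → Tm → Tm
ssub u (var n)       = var n
ssub u star          = star
ssub u (pair t v)    = pair (ssub u t) (ssub u v)
ssub u (fst t)       = fst (ssub u t)
ssub u (snd t)       = snd (ssub u t)
ssub u (lam A t)     = lam A (ssub (shift u) t)
ssub u (app t v)     = app (ssub u t) (ssub u v)
ssub u svar          = u
ssub u cstar         = cstar
ssub u (cpair t v)   = cpair (ssub u t) (ssub u v)
ssub u (cfst t)      = cfst (ssub u t)
ssub u (csnd t)      = csnd (ssub u t)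
ssub u (clam A t)    = clam A (ssub (shift u) t)
ssub u (capp t v)    = capp (ssub u t) (ssub u v)
ssub u top           = top
ssub u (letTop t v)  = letTop (ssub u t) (ssub u v)
ssub u (bang t)      = bang (ssub u t)
ssub u (letBang t v) = letBang (ssub u t) (ssub (shift u) v)
ssub u (tens t v)    = tens (ssub u t) (ssub u v)
ssub u (letTens t v) = letTens (ssub u t) v
ssub u (abort A t)   = abort A (ssub u t)
ssub u (inl t)       = inl (ssub u t)
ssub u (inr t)       = inr (ssub u t)
ssub u (case s t v)  = case (ssub u s) t v
ssub u (llam A t)    = llam A t
ssub u (lapp t v)    = lapp (ssub u t) (ssub u v)

-- Typing.  Ctx: newest variable first.  Stoup: nothing (empty) or just C.

Ctx : Set
Ctx = List VTy

Stoup : Set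
Stoup = Maybe CTy

data _∋_∶_ : Ctx → ℕ → VTy → Set where
  here  : ∀ {Γ A} → (A ∷ Γ) ∋ zero ∶ A
  there : ∀ {Γ A B n} → Γ ∋ n ∶ A → (B ∷ Γ) ∋ suc n ∶ A

infix 4 _∋_∶_ _∣_⊢_∶_ _∣_⊢_≈_∶_

data _∣_⊢_∶_ : Ctx → Stoup → Tm → VTy → Set where
  ty-var   : ∀ {Γ n A} → Γ ∋ n ∶ A → Γ ∣ nothing ⊢ var n ∶ A
  ty-star  : ∀ {Γ} → Γ ∣ nothing ⊢ star ∶ 𝟙
  ty-pair  : ∀ {Γ t u A B} → Γ ∣ nothing ⊢ t ∶ A → Γ ∣ nothing ⊢ u ∶ B
           → Γ ∣ nothing ⊢ pair t u ∶ A ×ᵗ B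
  ty-fst   : ∀ {Γ t A B} → Γ ∣ nothing ⊢ t ∶ A ×ᵗ B → Γ ∣ nothing ⊢ fst t ∶ A
  ty-snd   : ∀ {Γ t A B} → Γ ∣ nothing ⊢ t ∶ A ×ᵗ B → Γ ∣ nothing ⊢ snd t ∶ B
  ty-lam   : ∀ {Γ t A B} → (A ∷ Γ) ∣ nothing ⊢ t ∶ B → Γ ∣ nothing ⊢ lam A t ∶ A ⇒ B
  ty-app   : ∀ {Γ t u A B} → Γ ∣ nothing ⊢ t ∶ A ⇒ B → Γ ∣ nothing ⊢ u ∶ A
           → Γ ∣ nothing ⊢ app t u ∶ B
  ty-svar  : ∀ {Γ A} → Γ ∣ just A ⊢ svar ∶ ⌞ A ⌟
  ty-cstar : ∀ {Γ Δ} → Γ ∣ Δ ⊢ cstar ∶ ⌞ 𝟙ᶜ ⌟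
  ty-cpair : ∀ {Γ Δ t u A B} → Γ ∣ Δ ⊢ t ∶ ⌞ A ⌟ → Γ ∣ Δ ⊢ u ∶ ⌞ B ⌟
           → Γ ∣ Δ ⊢ cpair t u ∶ ⌞ A & B ⌟
  ty-cfst  : ∀ {Γ Δ t A B} → Γ ∣ Δ ⊢ t ∶ ⌞ A & B ⌟ → Γ ∣ Δ ⊢ cfst t ∶ ⌞ A ⌟
  ty-csnd  : ∀ {Γ Δ t A B} → Γ ∣ Δ ⊢ t ∶ ⌞ A & B ⌟ → Γ ∣ Δ ⊢ csnd t ∶ ⌞ B ⌟
  ty-clam  : ∀ {Γ Δ t A B} → (A ∷ Γ) ∣ Δ ⊢ t ∶ ⌞ B ⌟ → Γ ∣ Δ ⊢ clam A t ∶ ⌞ A ⇛ B ⌟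
  ty-capp  : ∀ {Γ Δ s t A B} → Γ ∣ Δ ⊢ s ∶ ⌞ A ⇛ B ⌟ → Γ ∣ nothing ⊢ t ∶ A
           → Γ ∣ Δ ⊢ capp s t ∶ ⌞ B ⌟
  ty-top   : ∀ {Γ} → Γ ∣ nothing ⊢ top ∶ ⌞ Iᶜ ⌟
  ty-letTop : ∀ {Γ Δ t u A} → Γ ∣ Δ ⊢ t ∶ ⌞ Iᶜ ⌟ → Γ ∣ nothing ⊢ u ∶ ⌞ A ⌟
            → Γ ∣ Δ ⊢ letTop t u ∶ ⌞ A ⌟
  ty-bang  : ∀ {Γ t A} → Γ ∣ nothing ⊢ t ∶ A → Γ ∣ nothing ⊢ bang t ∶ ⌞ ! A ⌟
  ty-letBang : ∀ {Γ Δ t u A B} → Γ ∣ Δ ⊢ t ∶ ⌞ ! A ⌟ → (A ∷ Γ) ∣ nothing ⊢ u ∶ ⌞ B ⌟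
             → Γ ∣ Δ ⊢ letBang t u ∶ ⌞ B ⌟
  ty-tens  : ∀ {Γ Δ t u A B} → Γ ∣ nothing ⊢ t ∶ A → Γ ∣ Δ ⊢ u ∶ ⌞ B ⌟
           → Γ ∣ Δ ⊢ tens t u ∶ ⌞ A !⊗ B ⌟
  ty-letTens : ∀ {Γ Δ s t A B C} → Γ ∣ Δ ⊢ s ∶ ⌞ A !⊗ B ⌟ → (A ∷ Γ) ∣ just B ⊢ t ∶ ⌞ C ⌟
             → Γ ∣ Δ ⊢ letTens s t ∶ ⌞ C ⌟
  ty-abort : ∀ {Γ Δ t A} → Γ ∣ Δ ⊢ t ∶ ⌞ 𝟘ᶜ ⌟ → Γ ∣ Δ ⊢ abort A t ∶ ⌞ A ⌟
  ty-inl   : ∀ {Γ Δ t A B} → Γ ∣ Δ ⊢ t ∶ ⌞ A ⌟ → Γ ∣ Δ ⊢ inl t ∶ ⌞ A ⊕ B ⌟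
  ty-inr   : ∀ {Γ Δ t A B} → Γ ∣ Δ ⊢ t ∶ ⌞ B ⌟ → Γ ∣ Δ ⊢ inr t ∶ ⌞ A ⊕ B ⌟
  ty-case  : ∀ {Γ Δ s t u A B C} → Γ ∣ Δ ⊢ s ∶ ⌞ A ⊕ B ⌟
           → Γ ∣ just A ⊢ t ∶ ⌞ C ⌟ → Γ ∣ just B ⊢ u ∶ ⌞ C ⌟
           → Γ ∣ Δ ⊢ case s t u ∶ ⌞ C ⌟
  ty-llam  : ∀ {Γ t A B} → Γ ∣ just A ⊢ t ∶ ⌞ B ⌟ → Γ ∣ nothing ⊢ llam A t ∶ A ⊸ B
  ty-lapp  : ∀ {Γ Δ s t A B} → Γ ∣ nothing ⊢ s ∶ A ⊸ B → Γ ∣ Δ ⊢ t ∶ ⌞ A ⌟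
           → Γ ∣ Δ ⊢ lapp s t ∶ ⌞ B ⌟

data _∣_⊢_≈_∶_ : Ctx → Stoup → Tm → Tm → VTy → Set where
  ≈-refl  : ∀ {Γ Δ t A} → Γ ∣ Δ ⊢ t ∶ A → Γ ∣ Δ ⊢ t ≈ t ∶ A
  ≈-sym   : ∀ {Γ Δ t u A} → Γ ∣ Δ ⊢ t ≈ u ∶ A → Γ ∣ Δ ⊢ u ≈ t ∶ A
  ≈-trans : ∀ {Γ Δ t u v A} → Γ ∣ Δ ⊢ t ≈ u ∶ A → Γ ∣ Δ ⊢ u ≈ v ∶ A → Γ ∣ Δ ⊢ t ≈ v ∶ A
  c-pair  : ∀ {Γ t t' u u' A B} → Γ ∣ nothing ⊢ t ≈ t' ∶ A → Γ ∣ nothing ⊢ u ≈ u' ∶ B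
          → Γ ∣ nothing ⊢ pair t u ≈ pair t' u' ∶ A ×ᵗ B
  c-fst   : ∀ {Γ t t' A B} → Γ ∣ nothing ⊢ t ≈ t' ∶ A ×ᵗ B → Γ ∣ nothing ⊢ fst t ≈ fst t' ∶ A
  c-snd   : ∀ {Γ t t' A B} → Γ ∣ nothing ⊢ t ≈ t' ∶ A ×ᵗ B → Γ ∣ nothing ⊢ snd t ≈ snd t' ∶ B
  c-lam   : ∀ {Γ t t' A B} → (A ∷ Γ) ∣ nothing ⊢ t ≈ t' ∶ B
          → Γ ∣ nothing ⊢ lam A t ≈ lam A t' ∶ A ⇒ B
  c-app   : ∀ {Γ t t' u u' A B} → Γ ∣ nothing ⊢ t ≈ t' ∶ A ⇒ B → Γ ∣ nothing ⊢ u ≈ u' ∶ A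
          → Γ ∣ nothing ⊢ app t u ≈ app t' u' ∶ B
  c-cpair : ∀ {Γ Δ t t' u u' A B} → Γ ∣ Δ ⊢ t ≈ t' ∶ ⌞ A ⌟ → Γ ∣ Δ ⊢ u ≈ u' ∶ ⌞ B ⌟
          → Γ ∣ Δ ⊢ cpair t u ≈ cpair t' u' ∶ ⌞ A & B ⌟
  c-cfst  : ∀ {Γ Δ t t' A B} → Γ ∣ Δ ⊢ t ≈ t' ∶ ⌞ A & B ⌟ → Γ ∣ Δ ⊢ cfst t ≈ cfst t' ∶ ⌞ A ⌟
  c-csnd  : ∀ {Γ Δ t t' A B} → Γ ∣ Δ ⊢ t ≈ t' ∶ ⌞ A & B ⌟ → Γ ∣ Δ ⊢ csnd t ≈ csnd t' ∶ ⌞ B ⌟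
  c-clam  : ∀ {Γ Δ t t' A B} → (A ∷ Γ) ∣ Δ ⊢ t ≈ t' ∶ ⌞ B ⌟
          → Γ ∣ Δ ⊢ clam A t ≈ clam A t' ∶ ⌞ A ⇛ B ⌟
  c-capp  : ∀ {Γ Δ s s' t t' A B} → Γ ∣ Δ ⊢ s ≈ s' ∶ ⌞ A ⇛ B ⌟ → Γ ∣ nothing ⊢ t ≈ t' ∶ A
          → Γ ∣ Δ ⊢ capp s t ≈ capp s' t' ∶ ⌞ B ⌟
  c-letTop : ∀ {Γ Δ t t' u u' A} → Γ ∣ Δ ⊢ t ≈ t' ∶ ⌞ Iᶜ ⌟ → Γ ∣ nothing ⊢ u ≈ u' ∶ ⌞ A ⌟
           → Γ ∣ Δ ⊢ letTop t u ≈ letTop t' u' ∶ ⌞ A ⌟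
  c-bang  : ∀ {Γ t t' A} → Γ ∣ nothing ⊢ t ≈ t' ∶ A → Γ ∣ nothing ⊢ bang t ≈ bang t' ∶ ⌞ ! A ⌟
  c-letBang : ∀ {Γ Δ t t' u u' A B} → Γ ∣ Δ ⊢ t ≈ t' ∶ ⌞ ! A ⌟
            → (A ∷ Γ) ∣ nothing ⊢ u ≈ u' ∶ ⌞ B ⌟
            → Γ ∣ Δ ⊢ letBang t u ≈ letBang t' u' ∶ ⌞ B ⌟
  c-tens  : ∀ {Γ Δ t t' u u' A B} → Γ ∣ nothing ⊢ t ≈ t' ∶ A → Γ ∣ Δ ⊢ u ≈ u' ∶ ⌞ B ⌟
          → Γ ∣ Δ ⊢ tens t u ≈ tens t' u' ∶ ⌞ A !⊗ B ⌟
  c-letTens : ∀ {Γ Δ s s' t t' A B C} → Γ ∣ Δ ⊢ s ≈ s' ∶ ⌞ A !⊗ B ⌟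
            → (A ∷ Γ) ∣ just B ⊢ t ≈ t' ∶ ⌞ C ⌟
            → Γ ∣ Δ ⊢ letTens s t ≈ letTens s' t' ∶ ⌞ C ⌟
  c-abort : ∀ {Γ Δ t t' A} → Γ ∣ Δ ⊢ t ≈ t' ∶ ⌞ 𝟘ᶜ ⌟ → Γ ∣ Δ ⊢ abort A t ≈ abort A t' ∶ ⌞ A ⌟
  c-inl   : ∀ {Γ Δ t t' A B} → Γ ∣ Δ ⊢ t ≈ t' ∶ ⌞ A ⌟ → Γ ∣ Δ ⊢ inl t ≈ inl t' ∶ ⌞ A ⊕ B ⌟
  c-inr   : ∀ {Γ Δ t t' A B} → Γ ∣ Δ ⊢ t ≈ t' ∶ ⌞ B ⌟ → Γ ∣ Δ ⊢ inr t ≈ inr t' ∶ ⌞ A ⊕ B ⌟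
  c-case  : ∀ {Γ Δ s s' t t' u u' A B C} → Γ ∣ Δ ⊢ s ≈ s' ∶ ⌞ A ⊕ B ⌟
          → Γ ∣ just A ⊢ t ≈ t' ∶ ⌞ C ⌟ → Γ ∣ just B ⊢ u ≈ u' ∶ ⌞ C ⌟
          → Γ ∣ Δ ⊢ case s t u ≈ case s' t' u' ∶ ⌞ C ⌟
  c-llam  : ∀ {Γ t t' A B} → Γ ∣ just A ⊢ t ≈ t' ∶ ⌞ B ⌟
          → Γ ∣ nothing ⊢ llam A t ≈ llam A t' ∶ A ⊸ B
  c-lapp  : ∀ {Γ Δ s s' t t' A B} → Γ ∣ nothing ⊢ s ≈ s' ∶ A ⊸ B → Γ ∣ Δ ⊢ t ≈ t' ∶ ⌞ A ⌟
          → Γ ∣ Δ ⊢ lapp s t ≈ lapp s' t' ∶ ⌞ B ⌟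
  ax-1η    : ∀ {Γ t} → Γ ∣ nothing ⊢ t ∶ 𝟙 → Γ ∣ nothing ⊢ t ≈ star ∶ 𝟙
  ax-×β₁   : ∀ {Γ t u A B} → Γ ∣ nothing ⊢ t ∶ A → Γ ∣ nothing ⊢ u ∶ B
           → Γ ∣ nothing ⊢ fst (pair t u) ≈ t ∶ A
  ax-×β₂   : ∀ {Γ t u A B} → Γ ∣ nothing ⊢ t ∶ A → Γ ∣ nothing ⊢ u ∶ B
           → Γ ∣ nothing ⊢ snd (pair t u) ≈ u ∶ B
  ax-×η    : ∀ {Γ t A B} → Γ ∣ nothing ⊢ t ∶ A ×ᵗ B
           → Γ ∣ nothing ⊢ pair (fst t) (snd t) ≈ t ∶ A ×ᵗ B
  ax-→β    : ∀ {Γ t u A B} → (A ∷ Γ) ∣ nothing ⊢ t ∶ B → Γ ∣ nothing ⊢ u ∶ A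
           → Γ ∣ nothing ⊢ app (lam A t) u ≈ sub1 u t ∶ B
  ax-→η    : ∀ {Γ t A B} → Γ ∣ nothing ⊢ t ∶ A ⇒ B
           → Γ ∣ nothing ⊢ lam A (app (shift t) (var zero)) ≈ t ∶ A ⇒ B
  ax-1̲η    : ∀ {Γ Δ t} → Γ ∣ Δ ⊢ t ∶ ⌞ 𝟙ᶜ ⌟ → Γ ∣ Δ ⊢ t ≈ cstar ∶ ⌞ 𝟙ᶜ ⌟
  ax-&β₁   : ∀ {Γ Δ t u A B} → Γ ∣ Δ ⊢ t ∶ ⌞ A ⌟ → Γ ∣ Δ ⊢ u ∶ ⌞ B ⌟
           → Γ ∣ Δ ⊢ cfst (cpair t u) ≈ t ∶ ⌞ A ⌟
  ax-&β₂   : ∀ {Γ Δ t u A B} → Γ ∣ Δ ⊢ t ∶ ⌞ A ⌟ → Γ ∣ Δ ⊢ u ∶ ⌞ B ⌟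
           → Γ ∣ Δ ⊢ csnd (cpair t u) ≈ u ∶ ⌞ B ⌟
  ax-&η    : ∀ {Γ Δ t A B} → Γ ∣ Δ ⊢ t ∶ ⌞ A & B ⌟
           → Γ ∣ Δ ⊢ cpair (cfst t) (csnd t) ≈ t ∶ ⌞ A & B ⌟
  ax-⇛β    : ∀ {Γ Δ t u A B} → (A ∷ Γ) ∣ Δ ⊢ t ∶ ⌞ B ⌟ → Γ ∣ nothing ⊢ u ∶ A
           → Γ ∣ Δ ⊢ capp (clam A t) u ≈ sub1 u t ∶ ⌞ B ⌟
  ax-⇛η    : ∀ {Γ Δ t A B} → Γ ∣ Δ ⊢ t ∶ ⌞ A ⇛ B ⌟
           → Γ ∣ Δ ⊢ clam A (capp (shift t) (var zero)) ≈ t ∶ ⌞ A ⇛ B ⌟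
  ax-Iβ    : ∀ {Γ t A} → Γ ∣ nothing ⊢ t ∶ ⌞ A ⌟
           → Γ ∣ nothing ⊢ letTop top t ≈ t ∶ ⌞ A ⌟
  ax-Iη    : ∀ {Γ Δ t u A} → Γ ∣ Δ ⊢ t ∶ ⌞ Iᶜ ⌟ → Γ ∣ just Iᶜ ⊢ u ∶ ⌞ A ⌟
           → Γ ∣ Δ ⊢ letTop t (ssub top u) ≈ ssub t u ∶ ⌞ A ⌟
  ax-!β    : ∀ {Γ t u A B} → Γ ∣ nothing ⊢ t ∶ A → (A ∷ Γ) ∣ nothing ⊢ u ∶ ⌞ B ⌟
           → Γ ∣ nothing ⊢ letBang (bang t) u ≈ sub1 t u ∶ ⌞ B ⌟
  ax-!η    : ∀ {Γ Δ t u A B} → Γ ∣ Δ ⊢ t ∶ ⌞ ! A ⌟ → Γ ∣ just (! A) ⊢ u ∶ ⌞ B ⌟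
           → Γ ∣ Δ ⊢ letBang t (ssub (bang (var zero)) (shift u)) ≈ ssub t u ∶ ⌞ B ⌟
  ax-⊗β    : ∀ {Γ Δ t s u A B C} → Γ ∣ nothing ⊢ t ∶ A → Γ ∣ Δ ⊢ s ∶ ⌞ B ⌟
           → (A ∷ Γ) ∣ just B ⊢ u ∶ ⌞ C ⌟
           → Γ ∣ Δ ⊢ letTens (tens t s) u ≈ ssub s (sub1 t u) ∶ ⌞ C ⌟
  ax-⊗η    : ∀ {Γ Δ t u A B C} → Γ ∣ Δ ⊢ t ∶ ⌞ A !⊗ B ⌟ → Γ ∣ just (A !⊗ B) ⊢ u ∶ ⌞ C ⌟
           → Γ ∣ Δ ⊢ letTens t (ssub (tens (var zero) svar) (shift u)) ≈ ssub t u ∶ ⌞ C ⌟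
  ax-0η    : ∀ {Γ Δ t u A} → Γ ∣ Δ ⊢ t ∶ ⌞ 𝟘ᶜ ⌟ → Γ ∣ just 𝟘ᶜ ⊢ u ∶ ⌞ A ⌟
           → Γ ∣ Δ ⊢ abort A t ≈ ssub t u ∶ ⌞ A ⌟
  ax-⊕β₁   : ∀ {Γ Δ t u u' A B C} → Γ ∣ Δ ⊢ t ∶ ⌞ A ⌟
           → Γ ∣ just A ⊢ u ∶ ⌞ C ⌟ → Γ ∣ just B ⊢ u' ∶ ⌞ C ⌟
           → Γ ∣ Δ ⊢ case (inl t) u u' ≈ ssub t u ∶ ⌞ C ⌟
  ax-⊕β₂   : ∀ {Γ Δ t u u' A B C} → Γ ∣ Δ ⊢ t ∶ ⌞ B ⌟
           → Γ ∣ just A ⊢ u ∶ ⌞ C ⌟ → Γ ∣ just B ⊢ u' ∶ ⌞ C ⌟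
           → Γ ∣ Δ ⊢ case (inr t) u u' ≈ ssub t u' ∶ ⌞ C ⌟
  ax-⊕η    : ∀ {Γ Δ t u A B C} → Γ ∣ Δ ⊢ t ∶ ⌞ A ⊕ B ⌟ → Γ ∣ just (A ⊕ B) ⊢ u ∶ ⌞ C ⌟
           → Γ ∣ Δ ⊢ case t (ssub (inl svar) u) (ssub (inr svar) u) ≈ ssub t u ∶ ⌞ C ⌟
  ax-⊸β    : ∀ {Γ Δ t u A B} → Γ ∣ just A ⊢ t ∶ ⌞ B ⌟ → Γ ∣ Δ ⊢ u ∶ ⌞ A ⌟
           → Γ ∣ Δ ⊢ lapp (llam A t) u ≈ ssub u t ∶ ⌞ B ⌟
  ax-⊸η    : ∀ {Γ t A B} → Γ ∣ nothing ⊢ t ∶ A ⊸ B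
           → Γ ∣ nothing ⊢ llam A (lapp t svar) ≈ t ∶ A ⊸ B

record IsIso (f g : Tm) (A B : VTy) : Set where
  field
    f-typed : [] ∣ nothing ⊢ f ∶ A ⇒ B
    g-typed : [] ∣ nothing ⊢ g ∶ B ⇒ A
    g∘f     : [] ∣ nothing ⊢ lam A (app g (app f (var zero))) ≈ lam A (var zero) ∶ A ⇒ A
    f∘g     : [] ∣ nothing ⊢ lam B (app f (app g (var zero))) ≈ lam B (var zero) ∶ B ⇒ B

record IsLinIso (f g : Tm) (A B : CTy) : Set where
  field
    f-typed : [] ∣ nothing ⊢ f ∶ A ⊸ B
    g-typed : [] ∣ nothing ⊢ g ∶ B ⊸ A
    g∘f     : [] ∣ nothing ⊢ llam A (lapp g (lapp f svar)) ≈ llam A svar ∶ A ⊸ A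
    f∘g     : [] ∣ nothing ⊢ llam B (lapp f (lapp g svar)) ≈ llam B svar ∶ B ⊸ B

-- Closed terms placed
-- under binders need no shifting in de Bruijn notation.

record ThetaFamily (R : CTy) (θ θ⁻¹ : VTy → Tm) (θc θc⁻¹ : CTy → Tm) : Set where
  open Translation R
  field
    θ-const : ∀ n → θ (vconst n) ≡ lam (vconst n) (var zero)
    θ-𝟙     : θ 𝟙 ≡ lam 𝟙 star
    θ-×     : ∀ A B → θ (A ×ᵗ B) ≡
                lam ((A •) • ×ᵗ (B •) •)
                    (pair (app (θ A) (fst (var zero))) (app (θ B) (snd (var zero))))
    θ-⇒     : ∀ A B → θ (A ⇒ B) ≡
                lam ((A •) • ⇒ (B •) •)
                    (lam A (app (θ B) (app (var (suc zero)) (app (θ⁻¹ A) (var zero)))))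
    θ-comp  : ∀ C → θ ⌞ C ⌟ ≡
                lam (Iᶜ ⊸ (C °) °) (lapp (θc C) (lapp (var zero) top))
    θ-⊸     : ∀ A B → θ (A ⊸ B) ≡
                lam ((A °) ° ⊸ (B °) °)
                    (llam A (lapp (θc B) (lapp (var zero) (lapp (θc⁻¹ A) svar))))
    θc-const : ∀ n → θc (cconst n) ≡ llam (cconst n) svar
    θc-𝟙     : θc 𝟙ᶜ ≡ llam 𝟙ᶜ cstar
    θc-&     : ∀ A B → θc (A & B) ≡
                 llam ((A °) ° & (B °) °)
                      (cpair (lapp (θc A) (cfst svar)) (lapp (θc B) (csnd svar)))
    θc-⇛     : ∀ A B → θc (A ⇛ B) ≡
                 llam ((A •) • ⇛ (B °) °)
                      (clam A (lapp (θc B) (capp svar (app (θ⁻¹ A) (var zero)))))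
    θc-I     : θc Iᶜ ≡ llam Iᶜ svar
    θc-!     : ∀ A → θc (! A) ≡
                 llam (((A •) •) !⊗ Iᶜ)
                      (letTens svar (letTop svar (bang (app (θ A) (var zero)))))
    θc-!⊗    : ∀ A B → θc (A !⊗ B) ≡
                 llam (((A •) •) !⊗ (B °) °)
                      (letTens svar (tens (app (θ A) (var zero)) (lapp (θc B) svar)))
    θc-𝟘     : θc 𝟘ᶜ ≡ llam 𝟘ᶜ svar
    θc-⊕     : ∀ A B → θc (A ⊕ B) ≡
                 llam ((A °) ° ⊕ (B °) °)
                      (case svar (inl (lapp (θc A) svar)) (inr (lapp (θc B) svar)))
    θ-iso  : ∀ A → IsIso (θ A) (θ⁻¹ A) ((A •) •) A
    θc-iso : ∀ C → IsLinIso (θc C) (θc⁻¹ C) ((C °) °) C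

module Submission where

-- The proof is "functoriality of the type formers on isomorphisms".  Each
-- clause of θ / θ̲ is an instance of a generic combinator that lifts closed
-- isomorphisms between the components to an isomorphism between the composite
-- types (A × B, A → B, A̲ ⊸ B̲, A̲ & B̲, A ⇒ B̲, !A ⊗ B̲, A̲ ⊕ B̲); the remaining
-- cases are the identity, the unit types, and the isomorphisms (I̲ ⊸ X̲) ≅ X̲
-- (a computation type seen as a value type) and !A ⊗ I̲ ≅ !A.
--
-- Finally
-- θ, θ̲ and their inverses are defined by simultaneous recursion on types out
-- of the combinators, so the defining clauses hold by definition, and the
-- isomorphism property follows by simultaneous induction.  The hypothesis on
-- R enters only through the type identities R° = I̲ and α̲°° = α̲.

open import Defs
open import Data.Nat using (ℕ; zero; suc; _≟_)
open import Data.Bool using (if_then_else_)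
open import Data.Product using (Σ; _,_)
open import Data.Sum using (_⊎_; inj₁; inj₂)
open import Data.Maybe using (just; nothing)
open import Data.List using ([]; _∷_)
open import Relation.Nullary using (yes; no)
open import Relation.Nullary.Decidable using (dec-true; dec-false)
open import Relation.Binary.PropositionalEquality
  using (_≡_; refl; sym; trans; cong; cong₂; subst)

cong₃ : ∀ {A B C D : Set} (f : A → B → C → D) {a a' b b' c c'}
      → a ≡ a' → b ≡ b' → c ≡ c' → f a b c ≡ f a' b' c'
cong₃ f refl refl refl = refl

v₀ : Tm
v₀ = var zero

v₀-ty : ∀ {Γ A} → (A ∷ Γ) ∣ nothing ⊢ v₀ ∶ A
v₀-ty = ty-var here

-- Chaining provable equalities, and adjusting an endpoint by a syntactic
-- identity (typically: a closed term is unchanged by a substitution).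
infixr 5 _⟫_
infixl 6 _⟫≡_
infixr 7 _≡⟫_

_⟫_ : ∀ {Γ Δ t u v A} → Γ ∣ Δ ⊢ t ≈ u ∶ A → Γ ∣ Δ ⊢ u ≈ v ∶ A → Γ ∣ Δ ⊢ t ≈ v ∶ A
_⟫_ = ≈-trans

_⟫≡_ : ∀ {Γ Δ t u u' A} → Γ ∣ Δ ⊢ t ≈ u ∶ A → u ≡ u' → Γ ∣ Δ ⊢ t ≈ u' ∶ A
p ⟫≡ refl = p

_≡⟫_ : ∀ {Γ Δ t t' u A} → t ≡ t' → Γ ∣ Δ ⊢ t' ≈ u ∶ A → Γ ∣ Δ ⊢ t ≈ u ∶ A
refl ≡⟫ p = p

RenTyped : Ctx → Ctx → (ℕ → ℕ) → Set
RenTyped Γ Γ' ρ = ∀ {n B} → Γ ∋ n ∶ B → Γ' ∋ ρ n ∶ B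

ext-typed : ∀ {Γ Γ' ρ A} → RenTyped Γ Γ' ρ → RenTyped (A ∷ Γ) (A ∷ Γ') (ext ρ)
ext-typed r here      = here
ext-typed r (there x) = there (r x)

⊢-ren : ∀ {Γ Γ' ρ Δ t A} → RenTyped Γ Γ' ρ → Γ ∣ Δ ⊢ t ∶ A → Γ' ∣ Δ ⊢ ren ρ t ∶ A
⊢-ren r (ty-var x)         = ty-var (r x)
⊢-ren r ty-star            = ty-star
⊢-ren r (ty-pair d e)      = ty-pair (⊢-ren r d) (⊢-ren r e)
⊢-ren r (ty-fst d)         = ty-fst (⊢-ren r d)
⊢-ren r (ty-snd d)         = ty-snd (⊢-ren r d)
⊢-ren r (ty-lam d)         = ty-lam (⊢-ren (ext-typed r) d)
⊢-ren r (ty-app d e)       = ty-app (⊢-ren r d) (⊢-ren r e)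
⊢-ren r ty-svar            = ty-svar
⊢-ren r ty-cstar           = ty-cstar
⊢-ren r (ty-cpair d e)     = ty-cpair (⊢-ren r d) (⊢-ren r e)
⊢-ren r (ty-cfst d)        = ty-cfst (⊢-ren r d)
⊢-ren r (ty-csnd d)        = ty-csnd (⊢-ren r d)
⊢-ren r (ty-clam d)        = ty-clam (⊢-ren (ext-typed r) d)
⊢-ren r (ty-capp d e)      = ty-capp (⊢-ren r d) (⊢-ren r e)
⊢-ren r ty-top             = ty-top
⊢-ren r (ty-letTop d e)    = ty-letTop (⊢-ren r d) (⊢-ren r e)
⊢-ren r (ty-bang d)        = ty-bang (⊢-ren r d)
⊢-ren r (ty-letBang d e)   = ty-letBang (⊢-ren r d) (⊢-ren (ext-typed r) e)
⊢-ren r (ty-tens d e)      = ty-tens (⊢-ren r d) (⊢-ren r e)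
⊢-ren r (ty-letTens d e)   = ty-letTens (⊢-ren r d) (⊢-ren (ext-typed r) e)
⊢-ren r (ty-abort d)       = ty-abort (⊢-ren r d)
⊢-ren r (ty-inl d)         = ty-inl (⊢-ren r d)
⊢-ren r (ty-inr d)         = ty-inr (⊢-ren r d)
⊢-ren r (ty-case d e f)    = ty-case (⊢-ren r d) (⊢-ren r e) (⊢-ren r f)
⊢-ren r (ty-llam d)        = ty-llam (⊢-ren r d)
⊢-ren r (ty-lapp d e)      = ty-lapp (⊢-ren r d) (⊢-ren r e)

⊢-weaken : ∀ {Γ Δ t A B} → Γ ∣ Δ ⊢ t ∶ A → (B ∷ Γ) ∣ Δ ⊢ shift t ∶ A
⊢-weaken = ⊢-ren there

-- A renaming (substitution) that fixes the variables of Γ fixes every term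
-- typed in Γ; for Γ = [] this says that closed terms are unaffected.
FixedByRen : Ctx → (ℕ → ℕ) → Set
FixedByRen Γ ρ = ∀ {n B} → Γ ∋ n ∶ B → ρ n ≡ n

ext-fixes : ∀ {Γ C ρ} → FixedByRen Γ ρ → FixedByRen (C ∷ Γ) (ext ρ)
ext-fixes h here      = refl
ext-fixes h (there x) = cong suc (h x)

ren-fixes : ∀ {Γ Δ t A ρ} → FixedByRen Γ ρ → Γ ∣ Δ ⊢ t ∶ A → ren ρ t ≡ t
ren-fixes h (ty-var x)       = cong var (h x)
ren-fixes h ty-star          = refl
ren-fixes h (ty-pair d e)    = cong₂ pair (ren-fixes h d) (ren-fixes h e)
ren-fixes h (ty-fst d)       = cong fst (ren-fixes h d)
ren-fixes h (ty-snd d)       = cong snd (ren-fixes h d)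
ren-fixes h (ty-lam d)       = cong (lam _) (ren-fixes (ext-fixes h) d)
ren-fixes h (ty-app d e)     = cong₂ app (ren-fixes h d) (ren-fixes h e)
ren-fixes h ty-svar          = refl
ren-fixes h ty-cstar         = refl
ren-fixes h (ty-cpair d e)   = cong₂ cpair (ren-fixes h d) (ren-fixes h e)
ren-fixes h (ty-cfst d)      = cong cfst (ren-fixes h d)
ren-fixes h (ty-csnd d)      = cong csnd (ren-fixes h d)
ren-fixes h (ty-clam d)      = cong (clam _) (ren-fixes (ext-fixes h) d)
ren-fixes h (ty-capp d e)    = cong₂ capp (ren-fixes h d) (ren-fixes h e)
ren-fixes h ty-top           = refl
ren-fixes h (ty-letTop d e)  = cong₂ letTop (ren-fixes h d) (ren-fixes h e)
ren-fixes h (ty-bang d)      = cong bang (ren-fixes h d)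
ren-fixes h (ty-letBang d e) = cong₂ letBang (ren-fixes h d) (ren-fixes (ext-fixes h) e)
ren-fixes h (ty-tens d e)    = cong₂ tens (ren-fixes h d) (ren-fixes h e)
ren-fixes h (ty-letTens d e) = cong₂ letTens (ren-fixes h d) (ren-fixes (ext-fixes h) e)
ren-fixes h (ty-abort d)     = cong (abort _) (ren-fixes h d)
ren-fixes h (ty-inl d)       = cong inl (ren-fixes h d)
ren-fixes h (ty-inr d)       = cong inr (ren-fixes h d)
ren-fixes h (ty-case d e f)  = cong₃ case (ren-fixes h d) (ren-fixes h e) (ren-fixes h f)
ren-fixes h (ty-llam d)      = cong (llam _) (ren-fixes h d)
ren-fixes h (ty-lapp d e)    = cong₂ lapp (ren-fixes h d) (ren-fixes h e)

FixedBySub : Ctx → (ℕ → Tm) → Set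
FixedBySub Γ σ = ∀ {n B} → Γ ∋ n ∶ B → σ n ≡ var n

exts-fixes : ∀ {Γ C σ} → FixedBySub Γ σ → FixedBySub (C ∷ Γ) (exts σ)
exts-fixes h here      = refl
exts-fixes h (there x) = cong shift (h x)

sub-fixes : ∀ {Γ Δ t A σ} → FixedBySub Γ σ → Γ ∣ Δ ⊢ t ∶ A → sub σ t ≡ t
sub-fixes h (ty-var x)       = h x
sub-fixes h ty-star          = refl
sub-fixes h (ty-pair d e)    = cong₂ pair (sub-fixes h d) (sub-fixes h e)
sub-fixes h (ty-fst d)       = cong fst (sub-fixes h d)
sub-fixes h (ty-snd d)       = cong snd (sub-fixes h d)
sub-fixes h (ty-lam d)       = cong (lam _) (sub-fixes (exts-fixes h) d)
sub-fixes h (ty-app d e)     = cong₂ app (sub-fixes h d) (sub-fixes h e)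
sub-fixes h ty-svar          = refl
sub-fixes h ty-cstar         = refl
sub-fixes h (ty-cpair d e)   = cong₂ cpair (sub-fixes h d) (sub-fixes h e)
sub-fixes h (ty-cfst d)      = cong cfst (sub-fixes h d)
sub-fixes h (ty-csnd d)      = cong csnd (sub-fixes h d)
sub-fixes h (ty-clam d)      = cong (clam _) (sub-fixes (exts-fixes h) d)
sub-fixes h (ty-capp d e)    = cong₂ capp (sub-fixes h d) (sub-fixes h e)
sub-fixes h ty-top           = refl
sub-fixes h (ty-letTop d e)  = cong₂ letTop (sub-fixes h d) (sub-fixes h e)
sub-fixes h (ty-bang d)      = cong bang (sub-fixes h d)
sub-fixes h (ty-letBang d e) = cong₂ letBang (sub-fixes h d) (sub-fixes (exts-fixes h) e)
sub-fixes h (ty-tens d e)    = cong₂ tens (sub-fixes h d) (sub-fixes h e)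
sub-fixes h (ty-letTens d e) = cong₂ letTens (sub-fixes h d) (sub-fixes (exts-fixes h) e)
sub-fixes h (ty-abort d)     = cong (abort _) (sub-fixes h d)
sub-fixes h (ty-inl d)       = cong inl (sub-fixes h d)
sub-fixes h (ty-inr d)       = cong inr (sub-fixes h d)
sub-fixes h (ty-case d e f)  = cong₃ case (sub-fixes h d) (sub-fixes h e) (sub-fixes h f)
sub-fixes h (ty-llam d)      = cong (llam _) (sub-fixes h d)
sub-fixes h (ty-lapp d e)    = cong₂ lapp (sub-fixes h d) (sub-fixes h e)

ssub-stoupless : ∀ {Γ t A} → Γ ∣ nothing ⊢ t ∶ A → ∀ u → ssub u t ≡ t
ssub-stoupless (ty-var x) u       = refl
ssub-stoupless ty-star u          = refl
ssub-stoupless (ty-pair d e) u    = cong₂ pair (ssub-stoupless d u) (ssub-stoupless e u)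
ssub-stoupless (ty-fst d) u       = cong fst (ssub-stoupless d u)
ssub-stoupless (ty-snd d) u       = cong snd (ssub-stoupless d u)
ssub-stoupless (ty-lam d) u       = cong (lam _) (ssub-stoupless d (shift u))
ssub-stoupless (ty-app d e) u     = cong₂ app (ssub-stoupless d u) (ssub-stoupless e u)
ssub-stoupless ty-cstar u         = refl
ssub-stoupless (ty-cpair d e) u   = cong₂ cpair (ssub-stoupless d u) (ssub-stoupless e u)
ssub-stoupless (ty-cfst d) u      = cong cfst (ssub-stoupless d u)
ssub-stoupless (ty-csnd d) u      = cong csnd (ssub-stoupless d u)
ssub-stoupless (ty-clam d) u      = cong (clam _) (ssub-stoupless d (shift u))
ssub-stoupless (ty-capp d e) u    = cong₂ capp (ssub-stoupless d u) (ssub-stoupless e u)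
ssub-stoupless ty-top u           = refl
ssub-stoupless (ty-letTop d e) u  = cong₂ letTop (ssub-stoupless d u) (ssub-stoupless e u)
ssub-stoupless (ty-bang d) u      = cong bang (ssub-stoupless d u)
ssub-stoupless (ty-letBang d e) u = cong₂ letBang (ssub-stoupless d u) (ssub-stoupless e (shift u))
ssub-stoupless (ty-tens d e) u    = cong₂ tens (ssub-stoupless d u) (ssub-stoupless e u)
ssub-stoupless (ty-letTens d e) u = cong (λ s → letTens s _) (ssub-stoupless d u)
ssub-stoupless (ty-abort d) u     = cong (abort _) (ssub-stoupless d u)
ssub-stoupless (ty-inl d) u       = cong inl (ssub-stoupless d u)
ssub-stoupless (ty-inr d) u       = cong inr (ssub-stoupless d u)
ssub-stoupless (ty-case d e f) u  = cong (λ s → case s _ _) (ssub-stoupless d u)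
ssub-stoupless (ty-llam d) u      = refl
ssub-stoupless (ty-lapp d e) u    = cong₂ lapp (ssub-stoupless d u) (ssub-stoupless e u)

exts-ext : ∀ {σ ρ τ} → (∀ n → σ (ρ n) ≡ τ n) → ∀ n → exts σ (ext ρ n) ≡ exts τ n
exts-ext h zero    = refl
exts-ext h (suc n) = cong shift (h n)

sub-ren : ∀ {σ ρ τ} → (∀ n → σ (ρ n) ≡ τ n) → ∀ t → sub σ (ren ρ t) ≡ sub τ t
sub-ren h (var x)       = h x
sub-ren h star          = refl
sub-ren h (pair t u)    = cong₂ pair (sub-ren h t) (sub-ren h u)
sub-ren h (fst t)       = cong fst (sub-ren h t)
sub-ren h (snd t)       = cong snd (sub-ren h t)
sub-ren h (lam A t)     = cong (lam A) (sub-ren (exts-ext h) t)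
sub-ren h (app t u)     = cong₂ app (sub-ren h t) (sub-ren h u)
sub-ren h svar          = refl
sub-ren h cstar         = refl
sub-ren h (cpair t u)   = cong₂ cpair (sub-ren h t) (sub-ren h u)
sub-ren h (cfst t)      = cong cfst (sub-ren h t)
sub-ren h (csnd t)      = cong csnd (sub-ren h t)
sub-ren h (clam A t)    = cong (clam A) (sub-ren (exts-ext h) t)
sub-ren h (capp t u)    = cong₂ capp (sub-ren h t) (sub-ren h u)
sub-ren h top           = refl
sub-ren h (letTop t u)  = cong₂ letTop (sub-ren h t) (sub-ren h u)
sub-ren h (bang t)      = cong bang (sub-ren h t)
sub-ren h (letBang t u) = cong₂ letBang (sub-ren h t) (sub-ren (exts-ext h) u)
sub-ren h (tens t u)    = cong₂ tens (sub-ren h t) (sub-ren h u)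
sub-ren h (letTens t u) = cong₂ letTens (sub-ren h t) (sub-ren (exts-ext h) u)
sub-ren h (abort A t)   = cong (abort A) (sub-ren h t)
sub-ren h (inl t)       = cong inl (sub-ren h t)
sub-ren h (inr t)       = cong inr (sub-ren h t)
sub-ren h (case s t u)  = cong₃ case (sub-ren h s) (sub-ren h t) (sub-ren h u)
sub-ren h (llam A t)    = cong (llam A) (sub-ren h t)
sub-ren h (lapp t u)    = cong₂ lapp (sub-ren h t) (sub-ren h u)

sub1-shift : ∀ {Γ Δ h A} y → Γ ∣ Δ ⊢ h ∶ A → sub1 y (shift h) ≡ h
sub1-shift {h = h} y d = trans (sub-ren (λ _ → refl) h) (sub-fixes (λ _ → refl) d)

Closed : Tm → VTy → Set
Closed f A = ∀ {Γ} → Γ ∣ nothing ⊢ f ∶ A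

closed-sub : ∀ {f A} → Closed f A → ∀ σ → sub σ f ≡ f
closed-sub d σ = sub-fixes {Γ = []} (λ ()) d

closed-ren : ∀ {f A} → Closed f A → ∀ ρ → ren ρ f ≡ f
closed-ren d ρ = ren-fixes {Γ = []} (λ ()) d

closed-ssub : ∀ {f A} → Closed f A → ∀ u → ssub u f ≡ f
closed-ssub d = ssub-stoupless (d {[]})

-- f : A → B and g : B → A are closed and mutually inverse, uniformly in the
-- context (the round trips are stated for arbitrary terms, not just under λ).
record ValIso (f g : Tm) (A B : VTy) : Set where
  field
    to-ty   : Closed f (A ⇒ B)
    from-ty : Closed g (B ⇒ A)
    from∘to : ∀ {Γ t} → Γ ∣ nothing ⊢ t ∶ A → Γ ∣ nothing ⊢ app g (app f t) ≈ t ∶ A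
    to∘from : ∀ {Γ t} → Γ ∣ nothing ⊢ t ∶ B → Γ ∣ nothing ⊢ app f (app g t) ≈ t ∶ B

ValIso-sym : ∀ {f g A B} → ValIso f g A B → ValIso g f B A
ValIso-sym i = record { to-ty = from-ty ; from-ty = to-ty ; from∘to = to∘from ; to∘from = from∘to }
  where open ValIso i

record LinIso (f g : Tm) (A B : CTy) : Set where
  field
    to-ty   : Closed f (A ⊸ B)
    from-ty : Closed g (B ⊸ A)
    from∘to : ∀ {Γ Δ t} → Γ ∣ Δ ⊢ t ∶ ⌞ A ⌟ → Γ ∣ Δ ⊢ lapp g (lapp f t) ≈ t ∶ ⌞ A ⌟
    to∘from : ∀ {Γ Δ t} → Γ ∣ Δ ⊢ t ∶ ⌞ B ⌟ → Γ ∣ Δ ⊢ lapp f (lapp g t) ≈ t ∶ ⌞ B ⌟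

LinIso-sym : ∀ {f g A B} → LinIso f g A B → LinIso g f B A
LinIso-sym i = record { to-ty = from-ty ; from-ty = to-ty ; from∘to = to∘from ; to∘from = from∘to }
  where open LinIso i

ValIso⇒IsIso : ∀ {f g A B} → ValIso f g A B → IsIso f g A B
ValIso⇒IsIso i = record { f-typed = to-ty ; g-typed = from-ty
                        ; g∘f = c-lam (from∘to v₀-ty) ; f∘g = c-lam (to∘from v₀-ty) }
  where open ValIso i

LinIso⇒IsLinIso : ∀ {f g A B} → LinIso f g A B → IsLinIso f g A B
LinIso⇒IsLinIso i = record { f-typed = to-ty ; g-typed = from-ty
                           ; g∘f = c-llam (from∘to ty-svar) ; f∘g = c-llam (to∘from ty-svar) }
  where open LinIso i

idMap : VTy → Tm
idMap X = lam X v₀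

idMap-iso : ∀ {X} → ValIso (idMap X) (idMap X) X X
idMap-iso = record { to-ty = ty-lam v₀-ty ; from-ty = ty-lam v₀-ty
                   ; from∘to = roundtrip ; to∘from = roundtrip }
  where
  β : ∀ {Γ X t} → Γ ∣ nothing ⊢ t ∶ X → Γ ∣ nothing ⊢ app (idMap X) t ≈ t ∶ X
  β d = ax-→β v₀-ty d
  roundtrip : ∀ {Γ X t} → Γ ∣ nothing ⊢ t ∶ X → Γ ∣ nothing ⊢ app (idMap X) (app (idMap X) t) ≈ t ∶ X
  roundtrip d = c-app (≈-refl (ty-lam v₀-ty)) (β d) ⟫ β d

unitMap : Tm
unitMap = lam 𝟙 star

unitMap-iso : ValIso unitMap unitMap 𝟙 𝟙
unitMap-iso = record { to-ty = ty-lam ty-star ; from-ty = ty-lam ty-star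
                     ; from∘to = roundtrip ; to∘from = roundtrip }
  where
  roundtrip : ∀ {Γ t} → Γ ∣ nothing ⊢ t ∶ 𝟙 → Γ ∣ nothing ⊢ app unitMap (app unitMap t) ≈ t ∶ 𝟙
  roundtrip d = ax-1η (ty-app (ty-lam ty-star) (ty-app (ty-lam ty-star) d)) ⟫ ≈-sym (ax-1η d)

×-map : VTy → Tm → Tm → Tm
×-map X f g = lam X (pair (app f (fst v₀)) (app g (snd v₀)))

module _ {f g A₁ A₂ B₁ B₂} (f-ty : Closed f (A₁ ⇒ B₁)) (g-ty : Closed g (A₂ ⇒ B₂)) where
  ×-map-body : ∀ {Γ} → ((A₁ ×ᵗ A₂) ∷ Γ) ∣ nothing ⊢ pair (app f (fst v₀)) (app g (snd v₀)) ∶ B₁ ×ᵗ B₂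
  ×-map-body = ty-pair (ty-app f-ty (ty-fst v₀-ty)) (ty-app g-ty (ty-snd v₀-ty))

  ×-map-ty : Closed (×-map (A₁ ×ᵗ A₂) f g) ((A₁ ×ᵗ A₂) ⇒ (B₁ ×ᵗ B₂))
  ×-map-ty = ty-lam ×-map-body

  ×-map-β : ∀ {Γ t} → Γ ∣ nothing ⊢ t ∶ A₁ ×ᵗ A₂
          → Γ ∣ nothing ⊢ app (×-map (A₁ ×ᵗ A₂) f g) t ≈ pair (app f (fst t)) (app g (snd t)) ∶ B₁ ×ᵗ B₂
  ×-map-β {t = t} d = ax-→β ×-map-body d
    ⟫≡ cong₂ (λ a b → pair (app a (fst t)) (app b (snd t))) (closed-sub f-ty _) (closed-sub g-ty _)

×-map-roundtrip : ∀ {f₁ g₁ f₂ g₂ A₁ A₂ B₁ B₂} → ValIso f₁ g₁ A₁ B₁ → ValIso f₂ g₂ A₂ B₂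
  → ∀ {Γ t} → Γ ∣ nothing ⊢ t ∶ A₁ ×ᵗ A₂
  → Γ ∣ nothing ⊢ app (×-map (B₁ ×ᵗ B₂) g₁ g₂) (app (×-map (A₁ ×ᵗ A₂) f₁ f₂) t) ≈ t ∶ A₁ ×ᵗ A₂
×-map-roundtrip i₁ i₂ d =
  c-app (≈-refl (×-map-ty I₁.from-ty I₂.from-ty)) (×-map-β I₁.to-ty I₂.to-ty d)
  ⟫ ×-map-β I₁.from-ty I₂.from-ty (ty-pair d₁ d₂)
  ⟫ c-pair (c-app (≈-refl I₁.from-ty) (ax-×β₁ d₁ d₂)) (c-app (≈-refl I₂.from-ty) (ax-×β₂ d₁ d₂))
  ⟫ c-pair (I₁.from∘to (ty-fst d)) (I₂.from∘to (ty-snd d))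
  ⟫ ax-×η d
  where
  module I₁ = ValIso i₁
  module I₂ = ValIso i₂
  d₁ = ty-app I₁.to-ty (ty-fst d)
  d₂ = ty-app I₂.to-ty (ty-snd d)

×-map-iso : ∀ {f₁ g₁ f₂ g₂ A₁ A₂ B₁ B₂} → ValIso f₁ g₁ A₁ B₁ → ValIso f₂ g₂ A₂ B₂
  → ValIso (×-map (A₁ ×ᵗ A₂) f₁ f₂) (×-map (B₁ ×ᵗ B₂) g₁ g₂) (A₁ ×ᵗ A₂) (B₁ ×ᵗ B₂)
×-map-iso i₁ i₂ = record
  { to-ty = ×-map-ty (ValIso.to-ty i₁) (ValIso.to-ty i₂)
  ; from-ty = ×-map-ty (ValIso.from-ty i₁) (ValIso.from-ty i₂)
  ; from∘to = ×-map-roundtrip i₁ i₂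
  ; to∘from = ×-map-roundtrip (ValIso-sym i₁) (ValIso-sym i₂) }

⇒-map : VTy → VTy → Tm → Tm → Tm
⇒-map X A f g = lam X (lam A (app g (app (var (suc zero)) (app f v₀))))

module _ {f g A A' B' B} (f-ty : Closed f (A ⇒ A')) (g-ty : Closed g (B' ⇒ B)) where
  ⇒-map-body : ∀ {Γ} → (A ∷ (A' ⇒ B') ∷ Γ) ∣ nothing ⊢ app g (app (var (suc zero)) (app f v₀)) ∶ B
  ⇒-map-body = ty-app g-ty (ty-app (ty-var (there here)) (ty-app f-ty v₀-ty))

  ⇒-map-ty : Closed (⇒-map (A' ⇒ B') A f g) ((A' ⇒ B') ⇒ (A ⇒ B))
  ⇒-map-ty = ty-lam (ty-lam ⇒-map-body)

  ⇒-map-β : ∀ {Γ h} → Γ ∣ nothing ⊢ h ∶ A' ⇒ B'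
    → Γ ∣ nothing ⊢ app (⇒-map (A' ⇒ B') A f g) h ≈ lam A (app g (app (shift h) (app f v₀))) ∶ A ⇒ B
  ⇒-map-β {h = h} d = ax-→β (ty-lam ⇒-map-body) d
    ⟫≡ cong₂ (λ a b → lam A (app a (app (shift h) (app b v₀)))) (closed-sub g-ty _) (closed-sub f-ty _)

  ⇒-map-β₂ : ∀ {Γ h y} → Γ ∣ nothing ⊢ h ∶ A' ⇒ B' → Γ ∣ nothing ⊢ y ∶ A
    → Γ ∣ nothing ⊢ app (app (⇒-map (A' ⇒ B') A f g) h) y ≈ app g (app h (app f y)) ∶ B
  ⇒-map-β₂ {h = h} {y} d e = c-app (⇒-map-β d) (≈-refl e)
    ⟫ ax-→β (ty-app g-ty (ty-app (⊢-weaken d) (ty-app f-ty v₀-ty))) e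
    ⟫≡ cong₃ (λ a b c → app a (app b (app c y))) (closed-sub g-ty _) (sub1-shift y d) (closed-sub f-ty _)

⇒-map-roundtrip : ∀ {p q r s A A' B' B} → ValIso p q A A' → ValIso r s B' B
  → ∀ {Γ t} → Γ ∣ nothing ⊢ t ∶ A' ⇒ B'
  → Γ ∣ nothing ⊢ app (⇒-map (A ⇒ B) A' q s) (app (⇒-map (A' ⇒ B') A p r) t) ≈ t ∶ A' ⇒ B'
⇒-map-roundtrip {q = q} {s = s} {A' = A'} i₁ i₂ {t = t} d =
  ⇒-map-β I₁.from-ty I₂.from-ty (ty-app forward d)
  ⟫≡ cong (λ m → lam A' (app s (app (app m (shift t)) (app q v₀)))) (closed-ren forward suc)
  ⟫ c-lam (c-app (≈-refl I₂.from-ty) (⇒-map-β₂ I₁.to-ty I₂.to-ty (⊢-weaken d) (ty-app I₁.from-ty v₀-ty)))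
  ⟫ c-lam (I₂.from∘to (ty-app (⊢-weaken d) (ty-app I₁.to-ty (ty-app I₁.from-ty v₀-ty))))
  ⟫ c-lam (c-app (≈-refl (⊢-weaken d)) (I₁.to∘from v₀-ty))
  ⟫ ax-→η d
  where
  module I₁ = ValIso i₁
  module I₂ = ValIso i₂
  forward = ⇒-map-ty I₁.to-ty I₂.to-ty

⇒-map-iso : ∀ {p q r s A A' B' B} → ValIso p q A A' → ValIso r s B' B
  → ValIso (⇒-map (A' ⇒ B') A p r) (⇒-map (A ⇒ B) A' q s) (A' ⇒ B') (A ⇒ B)
⇒-map-iso i₁ i₂ = record
  { to-ty = ⇒-map-ty (ValIso.to-ty i₁) (ValIso.to-ty i₂)
  ; from-ty = ⇒-map-ty (ValIso.from-ty i₁) (ValIso.from-ty i₂)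
  ; from∘to = ⇒-map-roundtrip i₁ i₂
  ; to∘from = ⇒-map-roundtrip (ValIso-sym i₁) (ValIso-sym i₂) }

⊸-map : VTy → CTy → Tm → Tm → Tm
⊸-map X A f g = lam X (llam A (lapp g (lapp v₀ (lapp f svar))))

module _ {f g A A' B' B} (f-ty : Closed f (A ⊸ A')) (g-ty : Closed g (B' ⊸ B)) where
  ⊸-map-body : ∀ {Γ} → ((A' ⊸ B') ∷ Γ) ∣ nothing ⊢ llam A (lapp g (lapp v₀ (lapp f svar))) ∶ A ⊸ B
  ⊸-map-body = ty-llam (ty-lapp g-ty (ty-lapp v₀-ty (ty-lapp f-ty ty-svar)))

  ⊸-map-ty : Closed (⊸-map (A' ⊸ B') A f g) ((A' ⊸ B') ⇒ (A ⊸ B))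
  ⊸-map-ty = ty-lam ⊸-map-body

  ⊸-map-β : ∀ {Γ h} → Γ ∣ nothing ⊢ h ∶ A' ⊸ B'
    → Γ ∣ nothing ⊢ app (⊸-map (A' ⊸ B') A f g) h ≈ llam A (lapp g (lapp h (lapp f svar))) ∶ A ⊸ B
  ⊸-map-β {h = h} d = ax-→β ⊸-map-body d
    ⟫≡ cong₂ (λ a b → llam A (lapp a (lapp h (lapp b svar)))) (closed-sub g-ty _) (closed-sub f-ty _)

⊸-map-roundtrip : ∀ {p q r s A A' B' B} → LinIso p q A A' → LinIso r s B' B
  → ∀ {Γ t} → Γ ∣ nothing ⊢ t ∶ A' ⊸ B'
  → Γ ∣ nothing ⊢ app (⊸-map (A ⊸ B) A' q s) (app (⊸-map (A' ⊸ B') A p r) t) ≈ t ∶ A' ⊸ B'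
⊸-map-roundtrip {q = q} i₁ i₂ {t = t} d =
  ⊸-map-β I₁.from-ty I₂.from-ty (ty-app (⊸-map-ty I₁.to-ty I₂.to-ty) d)
  ⟫ c-llam (c-lapp (≈-refl I₂.from-ty)
      (c-lapp (⊸-map-β I₁.to-ty I₂.to-ty d) (≈-refl (ty-lapp I₁.from-ty ty-svar))))
  ⟫ c-llam (c-lapp (≈-refl I₂.from-ty)
      (ax-⊸β (ty-lapp I₂.to-ty (ty-lapp d (ty-lapp I₁.to-ty ty-svar))) (ty-lapp I₁.from-ty ty-svar)
       ⟫≡ cong₃ (λ a b c → lapp a (lapp b (lapp c (lapp q svar))))
                (closed-ssub I₂.to-ty _) (ssub-stoupless d _) (closed-ssub I₁.to-ty _)))
  ⟫ c-llam (I₂.from∘to (ty-lapp d (ty-lapp I₁.to-ty (ty-lapp I₁.from-ty ty-svar))))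
  ⟫ c-llam (c-lapp (≈-refl d) (I₁.to∘from ty-svar))
  ⟫ ax-⊸η d
  where
  module I₁ = LinIso i₁
  module I₂ = LinIso i₂

⊸-map-iso : ∀ {p q r s A A' B' B} → LinIso p q A A' → LinIso r s B' B
  → ValIso (⊸-map (A' ⊸ B') A p r) (⊸-map (A ⊸ B) A' q s) (A' ⊸ B') (A ⊸ B)
⊸-map-iso i₁ i₂ = record
  { to-ty = ⊸-map-ty (LinIso.to-ty i₁) (LinIso.to-ty i₂)
  ; from-ty = ⊸-map-ty (LinIso.from-ty i₁) (LinIso.from-ty i₂)
  ; from∘to = ⊸-map-roundtrip i₁ i₂
  ; to∘from = ⊸-map-roundtrip (LinIso-sym i₁) (LinIso-sym i₂) }

-- η for I̲: a linear map out of I̲ is determined by its value at ⊤.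
I⊸-η : ∀ {Γ h X} → Γ ∣ nothing ⊢ h ∶ Iᶜ ⊸ X
     → Γ ∣ just Iᶜ ⊢ letTop svar (lapp h top) ≈ lapp h svar ∶ ⌞ X ⌟
I⊸-η {h = h} d =
  cong (λ a → letTop svar (lapp a top)) (sym (ssub-stoupless d top))
  ≡⟫ ax-Iη ty-svar (ty-lapp d ty-svar)
  ⟫≡ cong (λ a → lapp a svar) (ssub-stoupless d svar)

⊤-eval : CTy → Tm → Tm
⊤-eval X f = lam (Iᶜ ⊸ X) (lapp f (lapp v₀ top))

⊤-abstract : CTy → Tm → Tm
⊤-abstract Y g = lam ⌞ Y ⌟ (llam Iᶜ (letTop svar (lapp g v₀)))

I⊸-iso : ∀ {f g X Y} → LinIso f g X Y → ValIso (⊤-eval X f) (⊤-abstract Y g) (Iᶜ ⊸ X) ⌞ Y ⌟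
I⊸-iso {f} {g} {X} {Y} i = record
  { to-ty = ty-lam eval-body ; from-ty = ty-lam abstract-body
  ; from∘to = from∘to ; to∘from = to∘from }
  where
  module I = LinIso i
  eval-body : ∀ {Γ} → ((Iᶜ ⊸ X) ∷ Γ) ∣ nothing ⊢ lapp f (lapp v₀ top) ∶ ⌞ Y ⌟
  eval-body = ty-lapp I.to-ty (ty-lapp v₀-ty ty-top)
  abstract-body : ∀ {Γ} → (⌞ Y ⌟ ∷ Γ) ∣ nothing ⊢ llam Iᶜ (letTop svar (lapp g v₀)) ∶ Iᶜ ⊸ X
  abstract-body = ty-llam (ty-letTop ty-svar (ty-lapp I.from-ty v₀-ty))
  eval-β : ∀ {Γ h} → Γ ∣ nothing ⊢ h ∶ Iᶜ ⊸ X
         → Γ ∣ nothing ⊢ app (⊤-eval X f) h ≈ lapp f (lapp h top) ∶ ⌞ Y ⌟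
  eval-β {h = h} d = ax-→β eval-body d ⟫≡ cong (λ a → lapp a (lapp h top)) (closed-sub I.to-ty _)
  abstract-β : ∀ {Γ t} → Γ ∣ nothing ⊢ t ∶ ⌞ Y ⌟
             → Γ ∣ nothing ⊢ app (⊤-abstract Y g) t ≈ llam Iᶜ (letTop svar (lapp g t)) ∶ Iᶜ ⊸ X
  abstract-β {t = t} d = ax-→β abstract-body d
    ⟫≡ cong (λ a → llam Iᶜ (letTop svar (lapp a t))) (closed-sub I.from-ty _)
  to∘from : ∀ {Γ t} → Γ ∣ nothing ⊢ t ∶ ⌞ Y ⌟
          → Γ ∣ nothing ⊢ app (⊤-eval X f) (app (⊤-abstract Y g) t) ≈ t ∶ ⌞ Y ⌟
  to∘from {t = t} d = c-app (≈-refl (ty-lam eval-body)) (abstract-β d)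
    ⟫ eval-β (ty-llam (ty-letTop ty-svar (ty-lapp I.from-ty d)))
    ⟫ c-lapp (≈-refl I.to-ty)
        (ax-⊸β (ty-letTop ty-svar (ty-lapp I.from-ty d)) ty-top
         ⟫≡ cong₂ (λ a b → letTop top (lapp a b)) (closed-ssub I.from-ty _) (ssub-stoupless d _))
    ⟫ c-lapp (≈-refl I.to-ty) (ax-Iβ (ty-lapp I.from-ty d))
    ⟫ I.to∘from d
  from∘to : ∀ {Γ h} → Γ ∣ nothing ⊢ h ∶ Iᶜ ⊸ X
          → Γ ∣ nothing ⊢ app (⊤-abstract Y g) (app (⊤-eval X f) h) ≈ h ∶ Iᶜ ⊸ X
  from∘to d = abstract-β (ty-app (ty-lam eval-body) d)
    ⟫ c-llam (c-letTop (≈-refl ty-svar) (c-lapp (≈-refl I.from-ty) (eval-β d)))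
    ⟫ c-llam (c-letTop (≈-refl ty-svar) (I.from∘to (ty-lapp d ty-top)))
    ⟫ c-llam (I⊸-η d)
    ⟫ ax-⊸η d

linId : CTy → Tm
linId X = llam X svar

linId-iso : ∀ {X} → LinIso (linId X) (linId X) X X
linId-iso = record { to-ty = ty-llam ty-svar ; from-ty = ty-llam ty-svar
                   ; from∘to = roundtrip ; to∘from = roundtrip }
  where
  roundtrip : ∀ {Γ Δ X t} → Γ ∣ Δ ⊢ t ∶ ⌞ X ⌟
            → Γ ∣ Δ ⊢ lapp (linId X) (lapp (linId X) t) ≈ t ∶ ⌞ X ⌟
  roundtrip d = c-lapp (≈-refl (ty-llam ty-svar)) (ax-⊸β ty-svar d) ⟫ ax-⊸β ty-svar d

unitᶜMap : Tm
unitᶜMap = llam 𝟙ᶜ cstar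

unitᶜMap-iso : LinIso unitᶜMap unitᶜMap 𝟙ᶜ 𝟙ᶜ
unitᶜMap-iso = record { to-ty = ty-llam ty-cstar ; from-ty = ty-llam ty-cstar
                      ; from∘to = roundtrip ; to∘from = roundtrip }
  where
  roundtrip : ∀ {Γ Δ t} → Γ ∣ Δ ⊢ t ∶ ⌞ 𝟙ᶜ ⌟
            → Γ ∣ Δ ⊢ lapp unitᶜMap (lapp unitᶜMap t) ≈ t ∶ ⌞ 𝟙ᶜ ⌟
  roundtrip d = ax-1̲η (ty-lapp (ty-llam ty-cstar) (ty-lapp (ty-llam ty-cstar) d)) ⟫ ≈-sym (ax-1̲η d)

&-map : CTy → Tm → Tm → Tm
&-map X f g = llam X (cpair (lapp f (cfst svar)) (lapp g (csnd svar)))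

module _ {f g A₁ A₂ B₁ B₂} (f-ty : Closed f (A₁ ⊸ B₁)) (g-ty : Closed g (A₂ ⊸ B₂)) where
  &-map-body : ∀ {Γ} → Γ ∣ just (A₁ & A₂) ⊢ cpair (lapp f (cfst svar)) (lapp g (csnd svar)) ∶ ⌞ B₁ & B₂ ⌟
  &-map-body = ty-cpair (ty-lapp f-ty (ty-cfst ty-svar)) (ty-lapp g-ty (ty-csnd ty-svar))

  &-map-ty : Closed (&-map (A₁ & A₂) f g) ((A₁ & A₂) ⊸ (B₁ & B₂))
  &-map-ty = ty-llam &-map-body

  &-map-β : ∀ {Γ Δ t} → Γ ∣ Δ ⊢ t ∶ ⌞ A₁ & A₂ ⌟
          → Γ ∣ Δ ⊢ lapp (&-map (A₁ & A₂) f g) t ≈ cpair (lapp f (cfst t)) (lapp g (csnd t)) ∶ ⌞ B₁ & B₂ ⌟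
  &-map-β {t = t} d = ax-⊸β &-map-body d
    ⟫≡ cong₂ (λ a b → cpair (lapp a (cfst t)) (lapp b (csnd t))) (closed-ssub f-ty _) (closed-ssub g-ty _)

&-map-roundtrip : ∀ {f₁ g₁ f₂ g₂ A₁ A₂ B₁ B₂} → LinIso f₁ g₁ A₁ B₁ → LinIso f₂ g₂ A₂ B₂
  → ∀ {Γ Δ t} → Γ ∣ Δ ⊢ t ∶ ⌞ A₁ & A₂ ⌟
  → Γ ∣ Δ ⊢ lapp (&-map (B₁ & B₂) g₁ g₂) (lapp (&-map (A₁ & A₂) f₁ f₂) t) ≈ t ∶ ⌞ A₁ & A₂ ⌟
&-map-roundtrip i₁ i₂ d =
  c-lapp (≈-refl (&-map-ty I₁.from-ty I₂.from-ty)) (&-map-β I₁.to-ty I₂.to-ty d)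
  ⟫ &-map-β I₁.from-ty I₂.from-ty (ty-cpair d₁ d₂)
  ⟫ c-cpair (c-lapp (≈-refl I₁.from-ty) (ax-&β₁ d₁ d₂)) (c-lapp (≈-refl I₂.from-ty) (ax-&β₂ d₁ d₂))
  ⟫ c-cpair (I₁.from∘to (ty-cfst d)) (I₂.from∘to (ty-csnd d))
  ⟫ ax-&η d
  where
  module I₁ = LinIso i₁
  module I₂ = LinIso i₂
  d₁ = ty-lapp I₁.to-ty (ty-cfst d)
  d₂ = ty-lapp I₂.to-ty (ty-csnd d)

&-map-iso : ∀ {f₁ g₁ f₂ g₂ A₁ A₂ B₁ B₂} → LinIso f₁ g₁ A₁ B₁ → LinIso f₂ g₂ A₂ B₂
  → LinIso (&-map (A₁ & A₂) f₁ f₂) (&-map (B₁ & B₂) g₁ g₂) (A₁ & A₂) (B₁ & B₂)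
&-map-iso i₁ i₂ = record
  { to-ty = &-map-ty (LinIso.to-ty i₁) (LinIso.to-ty i₂)
  ; from-ty = &-map-ty (LinIso.from-ty i₁) (LinIso.from-ty i₂)
  ; from∘to = &-map-roundtrip i₁ i₂
  ; to∘from = &-map-roundtrip (LinIso-sym i₁) (LinIso-sym i₂) }

⇛-map : CTy → VTy → Tm → Tm → Tm
⇛-map X A f g = llam X (clam A (lapp g (capp svar (app f v₀))))

module _ {f g A A' B' B} (f-ty : Closed f (A ⇒ A')) (g-ty : Closed g (B' ⊸ B)) where
  ⇛-map-body : ∀ {Γ} → Γ ∣ just (A' ⇛ B') ⊢ clam A (lapp g (capp svar (app f v₀))) ∶ ⌞ A ⇛ B ⌟
  ⇛-map-body = ty-clam (ty-lapp g-ty (ty-capp ty-svar (ty-app f-ty v₀-ty)))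

  ⇛-map-ty : Closed (⇛-map (A' ⇛ B') A f g) ((A' ⇛ B') ⊸ (A ⇛ B))
  ⇛-map-ty = ty-llam ⇛-map-body

  ⇛-map-β : ∀ {Γ Δ h} → Γ ∣ Δ ⊢ h ∶ ⌞ A' ⇛ B' ⌟
    → Γ ∣ Δ ⊢ lapp (⇛-map (A' ⇛ B') A f g) h ≈ clam A (lapp g (capp (shift h) (app f v₀))) ∶ ⌞ A ⇛ B ⌟
  ⇛-map-β {h = h} d = ax-⊸β ⇛-map-body d
    ⟫≡ cong₂ (λ a b → clam A (lapp a (capp (shift h) (app b v₀)))) (closed-ssub g-ty _) (closed-ssub f-ty _)

  ⇛-map-β₂ : ∀ {Γ Δ h y} → Γ ∣ Δ ⊢ h ∶ ⌞ A' ⇛ B' ⌟ → Γ ∣ nothing ⊢ y ∶ A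
    → Γ ∣ Δ ⊢ capp (lapp (⇛-map (A' ⇛ B') A f g) h) y ≈ lapp g (capp h (app f y)) ∶ ⌞ B ⌟
  ⇛-map-β₂ {h = h} {y} d e = c-capp (⇛-map-β d) (≈-refl e)
    ⟫ ax-⇛β (ty-lapp g-ty (ty-capp (⊢-weaken d) (ty-app f-ty v₀-ty))) e
    ⟫≡ cong₃ (λ a b c → lapp a (capp b (app c y))) (closed-sub g-ty _) (sub1-shift y d) (closed-sub f-ty _)

⇛-map-roundtrip : ∀ {p q r s A A' B' B} → ValIso p q A A' → LinIso r s B' B
  → ∀ {Γ Δ t} → Γ ∣ Δ ⊢ t ∶ ⌞ A' ⇛ B' ⌟
  → Γ ∣ Δ ⊢ lapp (⇛-map (A ⇛ B) A' q s) (lapp (⇛-map (A' ⇛ B') A p r) t) ≈ t ∶ ⌞ A' ⇛ B' ⌟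
⇛-map-roundtrip {q = q} {s = s} {A' = A'} i₁ i₂ {t = t} d =
  ⇛-map-β I₁.from-ty I₂.from-ty (ty-lapp forward d)
  ⟫≡ cong (λ m → clam A' (lapp s (capp (lapp m (shift t)) (app q v₀)))) (closed-ren forward suc)
  ⟫ c-clam (c-lapp (≈-refl I₂.from-ty) (⇛-map-β₂ I₁.to-ty I₂.to-ty (⊢-weaken d) (ty-app I₁.from-ty v₀-ty)))
  ⟫ c-clam (I₂.from∘to (ty-capp (⊢-weaken d) (ty-app I₁.to-ty (ty-app I₁.from-ty v₀-ty))))
  ⟫ c-clam (c-capp (≈-refl (⊢-weaken d)) (I₁.to∘from v₀-ty))
  ⟫ ax-⇛η d
  where
  module I₁ = ValIso i₁
  module I₂ = LinIso i₂
  forward = ⇛-map-ty I₁.to-ty I₂.to-ty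

⇛-map-iso : ∀ {p q r s A A' B' B} → ValIso p q A A' → LinIso r s B' B
  → LinIso (⇛-map (A' ⇛ B') A p r) (⇛-map (A ⇛ B) A' q s) (A' ⇛ B') (A ⇛ B)
⇛-map-iso i₁ i₂ = record
  { to-ty = ⇛-map-ty (ValIso.to-ty i₁) (LinIso.to-ty i₂)
  ; from-ty = ⇛-map-ty (ValIso.from-ty i₁) (LinIso.from-ty i₂)
  ; from∘to = ⇛-map-roundtrip i₁ i₂
  ; to∘from = ⇛-map-roundtrip (ValIso-sym i₁) (LinIso-sym i₂) }

-- Extensionality for the positive computation types !A, !A ⊗ B̲ and A̲ ⊕ B̲:
-- a round trip g ∘ f through closed linear maps is the identity as soon as
-- it fixes the generic element (!x, !x ⊗ z, resp. inl z and inr z).  This is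
-- the η-law of the type, applied to the term g{f{z}} in the stoup variable z.
composite : Tm → Tm → Tm
composite f g = lapp g (lapp f svar)

module _ {f g A X} (f-ty : Closed f (A ⊸ X)) (g-ty : Closed g (X ⊸ A)) where
  composite-ty : ∀ {Γ} → Γ ∣ just A ⊢ composite f g ∶ ⌞ A ⌟
  composite-ty = ty-lapp g-ty (ty-lapp f-ty ty-svar)

  composite-at : ∀ u → ssub u (composite f g) ≡ lapp g (lapp f u)
  composite-at u = cong₂ (λ a b → lapp a (lapp b u)) (closed-ssub g-ty u) (closed-ssub f-ty u)

  weakened-composite-at : ∀ u → ssub u (shift (composite f g)) ≡ lapp g (lapp f u)
  weakened-composite-at u =
    cong₂ (λ a b → lapp a (lapp b u))
      (trans (cong (ssub u) (closed-ren g-ty suc)) (closed-ssub g-ty u))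
      (trans (cong (ssub u) (closed-ren f-ty suc)) (closed-ssub f-ty u))

module _ {f g A X} (f-ty : Closed f ((! A) ⊸ X)) (g-ty : Closed g (X ⊸ (! A)))
  (generic : ∀ {Γ} → (A ∷ Γ) ∣ nothing ⊢ lapp g (lapp f (bang v₀)) ≈ bang v₀ ∶ ⌞ ! A ⌟) where
  !-ext : ∀ {Γ Δ t} → Γ ∣ Δ ⊢ t ∶ ⌞ ! A ⌟ → Γ ∣ Δ ⊢ lapp g (lapp f t) ≈ t ∶ ⌞ ! A ⌟
  !-ext {t = t} d =
    sym (composite-at f-ty g-ty t)
    ≡⟫ ≈-sym (ax-!η d (composite-ty f-ty g-ty))
    ⟫≡ cong (letBang t) (weakened-composite-at f-ty g-ty (bang v₀))
    ⟫ c-letBang (≈-refl d) generic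
    ⟫ ax-!η d ty-svar

module _ {f g A B X} (f-ty : Closed f ((A !⊗ B) ⊸ X)) (g-ty : Closed g (X ⊸ (A !⊗ B)))
  (generic : ∀ {Γ} → (A ∷ Γ) ∣ just B ⊢ lapp g (lapp f (tens v₀ svar)) ≈ tens v₀ svar ∶ ⌞ A !⊗ B ⌟) where
  !⊗-ext : ∀ {Γ Δ t} → Γ ∣ Δ ⊢ t ∶ ⌞ A !⊗ B ⌟ → Γ ∣ Δ ⊢ lapp g (lapp f t) ≈ t ∶ ⌞ A !⊗ B ⌟
  !⊗-ext {t = t} d =
    sym (composite-at f-ty g-ty t)
    ≡⟫ ≈-sym (ax-⊗η d (composite-ty f-ty g-ty))
    ⟫≡ cong (letTens t) (weakened-composite-at f-ty g-ty (tens v₀ svar))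
    ⟫ c-letTens (≈-refl d) generic
    ⟫ ax-⊗η d ty-svar

module _ {f g A B X} (f-ty : Closed f ((A ⊕ B) ⊸ X)) (g-ty : Closed g (X ⊸ (A ⊕ B)))
  (generic-inl : ∀ {Γ} → Γ ∣ just A ⊢ lapp g (lapp f (inl svar)) ≈ inl svar ∶ ⌞ A ⊕ B ⌟)
  (generic-inr : ∀ {Γ} → Γ ∣ just B ⊢ lapp g (lapp f (inr svar)) ≈ inr svar ∶ ⌞ A ⊕ B ⌟) where
  ⊕-ext : ∀ {Γ Δ t} → Γ ∣ Δ ⊢ t ∶ ⌞ A ⊕ B ⌟ → Γ ∣ Δ ⊢ lapp g (lapp f t) ≈ t ∶ ⌞ A ⊕ B ⌟
  ⊕-ext {t = t} d =
    sym (composite-at f-ty g-ty t)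
    ≡⟫ ≈-sym (ax-⊕η d (composite-ty f-ty g-ty))
    ⟫≡ cong₂ (case t) (composite-at f-ty g-ty (inl svar)) (composite-at f-ty g-ty (inr svar))
    ⟫ c-case (≈-refl d) generic-inl generic-inr
    ⟫ ax-⊕η d ty-svar

!⊗-map : CTy → Tm → Tm → Tm
!⊗-map X f g = llam X (letTens svar (tens (app f v₀) (lapp g svar)))

module _ {f g A A' B B'} (f-ty : Closed f (A ⇒ A')) (g-ty : Closed g (B ⊸ B')) where
  !⊗-map-body : ∀ {Γ} → (A ∷ Γ) ∣ just B ⊢ tens (app f v₀) (lapp g svar) ∶ ⌞ A' !⊗ B' ⌟
  !⊗-map-body = ty-tens (ty-app f-ty v₀-ty) (ty-lapp g-ty ty-svar)

  !⊗-map-ty : Closed (!⊗-map (A !⊗ B) f g) ((A !⊗ B) ⊸ (A' !⊗ B'))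
  !⊗-map-ty = ty-llam (ty-letTens ty-svar !⊗-map-body)

  !⊗-map-β : ∀ {Γ Δ x y} → Γ ∣ nothing ⊢ x ∶ A → Γ ∣ Δ ⊢ y ∶ ⌞ B ⌟
    → Γ ∣ Δ ⊢ lapp (!⊗-map (A !⊗ B) f g) (tens x y) ≈ tens (app f x) (lapp g y) ∶ ⌞ A' !⊗ B' ⌟
  !⊗-map-β {x = x} {y} dx dy = ax-⊸β (ty-letTens ty-svar !⊗-map-body) (ty-tens dx dy)
    ⟫ ax-⊗β dx dy !⊗-map-body
    ⟫≡ cong₂ tens (trans (cong (λ a → ssub y (app a x)) (closed-sub f-ty _)) (ssub-stoupless (ty-app f-ty dx) y))
                  (cong (λ a → lapp a y) (trans (cong (ssub y) (closed-sub g-ty _)) (closed-ssub g-ty y)))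

!⊗-map-roundtrip : ∀ {f₁ g₁ f₂ g₂ A A' B B'} → ValIso f₁ g₁ A A' → LinIso f₂ g₂ B B'
  → ∀ {Γ Δ t} → Γ ∣ Δ ⊢ t ∶ ⌞ A !⊗ B ⌟
  → Γ ∣ Δ ⊢ lapp (!⊗-map (A' !⊗ B') g₁ g₂) (lapp (!⊗-map (A !⊗ B) f₁ f₂) t) ≈ t ∶ ⌞ A !⊗ B ⌟
!⊗-map-roundtrip i₁ i₂ = !⊗-ext (!⊗-map-ty I₁.to-ty I₂.to-ty) (!⊗-map-ty I₁.from-ty I₂.from-ty)
  ( c-lapp (≈-refl (!⊗-map-ty I₁.from-ty I₂.from-ty)) (!⊗-map-β I₁.to-ty I₂.to-ty v₀-ty ty-svar)
  ⟫ !⊗-map-β I₁.from-ty I₂.from-ty (ty-app I₁.to-ty v₀-ty) (ty-lapp I₂.to-ty ty-svar)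
  ⟫ c-tens (I₁.from∘to v₀-ty) (I₂.from∘to ty-svar))
  where
  module I₁ = ValIso i₁
  module I₂ = LinIso i₂

!⊗-map-iso : ∀ {f₁ g₁ f₂ g₂ A A' B B'} → ValIso f₁ g₁ A A' → LinIso f₂ g₂ B B'
  → LinIso (!⊗-map (A !⊗ B) f₁ f₂) (!⊗-map (A' !⊗ B') g₁ g₂) (A !⊗ B) (A' !⊗ B')
!⊗-map-iso i₁ i₂ = record
  { to-ty = !⊗-map-ty (ValIso.to-ty i₁) (LinIso.to-ty i₂)
  ; from-ty = !⊗-map-ty (ValIso.from-ty i₁) (LinIso.from-ty i₂)
  ; from∘to = !⊗-map-roundtrip i₁ i₂
  ; to∘from = !⊗-map-roundtrip (ValIso-sym i₁) (LinIso-sym i₂) }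

⊕-map : CTy → Tm → Tm → Tm
⊕-map X f g = llam X (case svar (inl (lapp f svar)) (inr (lapp g svar)))

module _ {f g A₁ A₂ B₁ B₂} (f-ty : Closed f (A₁ ⊸ B₁)) (g-ty : Closed g (A₂ ⊸ B₂)) where
  ⊕-map-left : ∀ {Γ} → Γ ∣ just A₁ ⊢ inl (lapp f svar) ∶ ⌞ B₁ ⊕ B₂ ⌟
  ⊕-map-left = ty-inl (ty-lapp f-ty ty-svar)

  ⊕-map-right : ∀ {Γ} → Γ ∣ just A₂ ⊢ inr (lapp g svar) ∶ ⌞ B₁ ⊕ B₂ ⌟
  ⊕-map-right = ty-inr (ty-lapp g-ty ty-svar)

  ⊕-map-ty : Closed (⊕-map (A₁ ⊕ A₂) f g) ((A₁ ⊕ A₂) ⊸ (B₁ ⊕ B₂))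
  ⊕-map-ty = ty-llam (ty-case ty-svar ⊕-map-left ⊕-map-right)

  ⊕-map-inl : ∀ {Γ Δ s} → Γ ∣ Δ ⊢ s ∶ ⌞ A₁ ⌟
    → Γ ∣ Δ ⊢ lapp (⊕-map (A₁ ⊕ A₂) f g) (inl s) ≈ inl (lapp f s) ∶ ⌞ B₁ ⊕ B₂ ⌟
  ⊕-map-inl {s = s} d = ax-⊸β (ty-case ty-svar ⊕-map-left ⊕-map-right) (ty-inl d)
    ⟫ ax-⊕β₁ d ⊕-map-left ⊕-map-right ⟫≡ cong (λ a → inl (lapp a s)) (closed-ssub f-ty s)

  ⊕-map-inr : ∀ {Γ Δ s} → Γ ∣ Δ ⊢ s ∶ ⌞ A₂ ⌟
    → Γ ∣ Δ ⊢ lapp (⊕-map (A₁ ⊕ A₂) f g) (inr s) ≈ inr (lapp g s) ∶ ⌞ B₁ ⊕ B₂ ⌟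
  ⊕-map-inr {s = s} d = ax-⊸β (ty-case ty-svar ⊕-map-left ⊕-map-right) (ty-inr d)
    ⟫ ax-⊕β₂ d ⊕-map-left ⊕-map-right ⟫≡ cong (λ a → inr (lapp a s)) (closed-ssub g-ty s)

⊕-map-roundtrip : ∀ {f₁ g₁ f₂ g₂ A₁ A₂ B₁ B₂} → LinIso f₁ g₁ A₁ B₁ → LinIso f₂ g₂ A₂ B₂
  → ∀ {Γ Δ t} → Γ ∣ Δ ⊢ t ∶ ⌞ A₁ ⊕ A₂ ⌟
  → Γ ∣ Δ ⊢ lapp (⊕-map (B₁ ⊕ B₂) g₁ g₂) (lapp (⊕-map (A₁ ⊕ A₂) f₁ f₂) t) ≈ t ∶ ⌞ A₁ ⊕ A₂ ⌟
⊕-map-roundtrip i₁ i₂ = ⊕-ext (⊕-map-ty I₁.to-ty I₂.to-ty) backward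
  ( c-lapp (≈-refl backward) (⊕-map-inl I₁.to-ty I₂.to-ty ty-svar)
  ⟫ ⊕-map-inl I₁.from-ty I₂.from-ty (ty-lapp I₁.to-ty ty-svar)
  ⟫ c-inl (I₁.from∘to ty-svar))
  ( c-lapp (≈-refl backward) (⊕-map-inr I₁.to-ty I₂.to-ty ty-svar)
  ⟫ ⊕-map-inr I₁.from-ty I₂.from-ty (ty-lapp I₂.to-ty ty-svar)
  ⟫ c-inr (I₂.from∘to ty-svar))
  where
  module I₁ = LinIso i₁
  module I₂ = LinIso i₂
  backward = ⊕-map-ty I₁.from-ty I₂.from-ty

⊕-map-iso : ∀ {f₁ g₁ f₂ g₂ A₁ A₂ B₁ B₂} → LinIso f₁ g₁ A₁ B₁ → LinIso f₂ g₂ A₂ B₂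
  → LinIso (⊕-map (A₁ ⊕ A₂) f₁ f₂) (⊕-map (B₁ ⊕ B₂) g₁ g₂) (A₁ ⊕ A₂) (B₁ ⊕ B₂)
⊕-map-iso i₁ i₂ = record
  { to-ty = ⊕-map-ty (LinIso.to-ty i₁) (LinIso.to-ty i₂)
  ; from-ty = ⊕-map-ty (LinIso.from-ty i₁) (LinIso.from-ty i₂)
  ; from∘to = ⊕-map-roundtrip i₁ i₂
  ; to∘from = ⊕-map-roundtrip (LinIso-sym i₁) (LinIso-sym i₂) }

-- Linear maps commute with  let ⊤ be t in − ; an instance of the η-law of I̲.
lapp-letTop : ∀ {Γ Δ h t u X Y} → Closed h (X ⊸ Y) → Γ ∣ Δ ⊢ t ∶ ⌞ Iᶜ ⌟ → Γ ∣ nothing ⊢ u ∶ ⌞ X ⌟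
  → Γ ∣ Δ ⊢ lapp h (letTop t u) ≈ letTop t (lapp h u) ∶ ⌞ Y ⌟
lapp-letTop {h = h} {t} {u} h-ty dt du =
  cong₂ (λ a b → lapp a (letTop t b)) (sym (closed-ssub h-ty t)) (sym (ssub-stoupless du t))
  ≡⟫ ≈-sym (ax-Iη dt (ty-lapp h-ty (ty-letTop ty-svar du)))
  ⟫≡ cong₂ (λ a b → letTop t (lapp a (letTop top b))) (closed-ssub h-ty top) (ssub-stoupless du top)
  ⟫ c-letTop (≈-refl dt) (c-lapp (≈-refl h-ty) (ax-Iβ du))

!-to : VTy → Tm → Tm
!-to X f = llam (X !⊗ Iᶜ) (letTens svar (letTop svar (bang (app f v₀))))

!-from : VTy → Tm → Tm
!-from Y g = llam (! Y) (letBang svar (tens (app g v₀) top))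

module _ {f X Y} (f-ty : Closed f (X ⇒ Y)) where
  !-to-body : ∀ {Γ} → (X ∷ Γ) ∣ just Iᶜ ⊢ letTop svar (bang (app f v₀)) ∶ ⌞ ! Y ⌟
  !-to-body = ty-letTop ty-svar (ty-bang (ty-app f-ty v₀-ty))

  !-to-ty : Closed (!-to X f) ((X !⊗ Iᶜ) ⊸ ! Y)
  !-to-ty = ty-llam (ty-letTens ty-svar !-to-body)

  !-to-β : ∀ {Γ Δ a s} → Γ ∣ nothing ⊢ a ∶ X → Γ ∣ Δ ⊢ s ∶ ⌞ Iᶜ ⌟
    → Γ ∣ Δ ⊢ lapp (!-to X f) (tens a s) ≈ letTop s (bang (app f a)) ∶ ⌞ ! Y ⌟
  !-to-β {a = a} {s} da ds = ax-⊸β (ty-letTens ty-svar !-to-body) (ty-tens da ds)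
    ⟫ ax-⊗β da ds !-to-body
    ⟫≡ cong (λ b → letTop s (bang b))
         (trans (cong (λ b → ssub s (app b a)) (closed-sub f-ty _)) (ssub-stoupless (ty-app f-ty da) s))

module _ {g X Y} (g-ty : Closed g (Y ⇒ X)) where
  !-from-body : ∀ {Γ} → (Y ∷ Γ) ∣ nothing ⊢ tens (app g v₀) top ∶ ⌞ X !⊗ Iᶜ ⌟
  !-from-body = ty-tens (ty-app g-ty v₀-ty) ty-top

  !-from-ty : Closed (!-from Y g) ((! Y) ⊸ (X !⊗ Iᶜ))
  !-from-ty = ty-llam (ty-letBang ty-svar !-from-body)

  !-from-β : ∀ {Γ y} → Γ ∣ nothing ⊢ y ∶ Y
    → Γ ∣ nothing ⊢ lapp (!-from Y g) (bang y) ≈ tens (app g y) top ∶ ⌞ X !⊗ Iᶜ ⌟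
  !-from-β {Γ} {y} dy = ax-⊸β (ty-letBang ty-svar !-from-body) (ty-bang dy)
    ⟫≡ cong (letBang (bang y)) (ssub-stoupless (!-from-body {Γ}) (shift (bang y)))
    ⟫ ax-!β dy !-from-body
    ⟫≡ cong (λ b → tens (app b y) top) (closed-sub g-ty _)

!-iso : ∀ {f g X Y} → ValIso f g X Y → LinIso (!-to X f) (!-from Y g) (X !⊗ Iᶜ) (! Y)
!-iso {f} {g} {X} {Y} i = record
  { to-ty = !-to-ty I.to-ty ; from-ty = !-from-ty I.from-ty
  ; from∘to = !⊗-ext (!-to-ty I.to-ty) (!-from-ty I.from-ty) generic-tens
  ; to∘from = !-ext (!-from-ty I.from-ty) (!-to-ty I.to-ty) generic-bang }
  where
  module I = ValIso i
  generic-bang : ∀ {Γ} → (Y ∷ Γ) ∣ nothing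
    ⊢ lapp (!-to X f) (lapp (!-from Y g) (bang v₀)) ≈ bang v₀ ∶ ⌞ ! Y ⌟
  generic-bang = c-lapp (≈-refl (!-to-ty I.to-ty)) (!-from-β I.from-ty v₀-ty)
    ⟫ !-to-β I.to-ty (ty-app I.from-ty v₀-ty) ty-top
    ⟫ ax-Iβ (ty-bang (ty-app I.to-ty (ty-app I.from-ty v₀-ty)))
    ⟫ c-bang (I.to∘from v₀-ty)
  generic-tens : ∀ {Γ} → (X ∷ Γ) ∣ just Iᶜ
    ⊢ lapp (!-from Y g) (lapp (!-to X f) (tens v₀ svar)) ≈ tens v₀ svar ∶ ⌞ X !⊗ Iᶜ ⌟
  generic-tens = c-lapp (≈-refl (!-from-ty I.from-ty)) (!-to-β I.to-ty v₀-ty ty-svar)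
    ⟫ lapp-letTop (!-from-ty I.from-ty) ty-svar (ty-bang (ty-app I.to-ty v₀-ty))
    ⟫ c-letTop (≈-refl ty-svar)
        (!-from-β I.from-ty (ty-app I.to-ty v₀-ty) ⟫ c-tens (I.from∘to v₀-ty) (≈-refl ty-top))
    ⟫ ax-Iη ty-svar (ty-tens v₀-ty ty-svar)

-- The two properties of the answer type R used by the proof: the translation
-- sends R to I̲ (so that the translated I̲ is I̲ again), and it is an
-- involution on computation-type constants.
record Involutive (R : CTy) : Set where
  open Translation R
  field
    R°≡I    : R ° ≡ Iᶜ
    const°° : ∀ m → cconst m ° ° ≡ cconst m

const-involutive : ∀ n → Involutive (cconst n)
const-involutive n = record { R°≡I = R°≡I ; const°° = const°° }
  where
  open Translation (cconst n)
  R°≡I : cconst n ° ≡ Iᶜ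
  R°≡I = cong (if_then Iᶜ else cconst n) (dec-true (n ≟ n) refl)
  const°° : ∀ m → cconst m ° ° ≡ cconst m
  const°° m with m ≟ n
  ... | yes refl = cong _° R°≡I
  ... | no m≢n   = trans (cong _° fixed) fixed
    where
    fixed : cconst m ° ≡ cconst m
    fixed = cong (if_then Iᶜ else cconst m) (dec-false (m ≟ n) m≢n)

I-involutive : Involutive Iᶜ
I-involutive = record { R°≡I = refl ; const°° = λ m → refl }

module Theta (R : CTy) where
  open Translation R

  mutual
    θ : VTy → Tm
    θ (vconst n) = idMap (vconst n)
    θ 𝟙          = unitMap
    θ (A ×ᵗ B)   = ×-map (A • • ×ᵗ B • •) (θ A) (θ B)
    θ (A ⇒ B)    = ⇒-map (A • • ⇒ B • •) A (θ⁻¹ A) (θ B)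
    θ ⌞ C ⌟      = ⊤-eval (C ° °) (θc C)
    θ (A ⊸ B)    = ⊸-map (A ° ° ⊸ B ° °) A (θc⁻¹ A) (θc B)

    θ⁻¹ : VTy → Tm
    θ⁻¹ (vconst n) = idMap (vconst n)
    θ⁻¹ 𝟙          = unitMap
    θ⁻¹ (A ×ᵗ B)   = ×-map (A ×ᵗ B) (θ⁻¹ A) (θ⁻¹ B)
    θ⁻¹ (A ⇒ B)    = ⇒-map (A ⇒ B) (A • •) (θ A) (θ⁻¹ B)
    θ⁻¹ ⌞ C ⌟      = ⊤-abstract C (θc⁻¹ C)
    θ⁻¹ (A ⊸ B)    = ⊸-map (A ⊸ B) (A ° °) (θc A) (θc⁻¹ B)

    θc : CTy → Tm
    θc (cconst n) = linId (cconst n)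
    θc 𝟙ᶜ         = unitᶜMap
    θc (A & B)    = &-map (A ° ° & B ° °) (θc A) (θc B)
    θc (A ⇛ B)    = ⇛-map (A • • ⇛ B ° °) A (θ⁻¹ A) (θc B)
    θc Iᶜ         = linId Iᶜ
    θc (! A)      = !-to (A • •) (θ A)
    θc (A !⊗ B)   = !⊗-map (A • • !⊗ B ° °) (θ A) (θc B)
    θc 𝟘ᶜ         = linId 𝟘ᶜ
    θc (A ⊕ B)    = ⊕-map (A ° ° ⊕ B ° °) (θc A) (θc B)

    θc⁻¹ : CTy → Tm
    θc⁻¹ (cconst n) = linId (cconst n)
    θc⁻¹ 𝟙ᶜ         = unitᶜMap
    θc⁻¹ (A & B)    = &-map (A & B) (θc⁻¹ A) (θc⁻¹ B)
    θc⁻¹ (A ⇛ B)    = ⇛-map (A ⇛ B) (A • •) (θ A) (θc⁻¹ B)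
    θc⁻¹ Iᶜ         = linId Iᶜ
    θc⁻¹ (! A)      = !-from A (θ⁻¹ A)
    θc⁻¹ (A !⊗ B)   = !⊗-map (A !⊗ B) (θ⁻¹ A) (θc⁻¹ B)
    θc⁻¹ 𝟘ᶜ         = linId 𝟘ᶜ
    θc⁻¹ (A ⊕ B)    = ⊕-map (A ⊕ B) (θc⁻¹ A) (θc⁻¹ B)

  -- Each θ_A and θ̲_A̲ is an isomorphism, by simultaneous induction on types;
  -- the type identities of Involutive R make the translated I̲ and constants
  -- match the combinators' types.
  module _ (inv : Involutive R) where
    open Involutive inv

    mutual
      θ-iso : ∀ A → ValIso (θ A) (θ⁻¹ A) (A • •) A
      θ-iso (vconst n) = idMap-iso
      θ-iso 𝟙          = unitMap-iso
      θ-iso (A ×ᵗ B)   = ×-map-iso (θ-iso A) (θ-iso B)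
      θ-iso (A ⇒ B)    = ⇒-map-iso (ValIso-sym (θ-iso A)) (θ-iso B)
      θ-iso ⌞ C ⌟      = subst (λ X → ValIso (θ ⌞ C ⌟) (θ⁻¹ ⌞ C ⌟) (X ⊸ C ° °) ⌞ C ⌟) (sym R°≡I)
                           (I⊸-iso (θc-iso C))
      θ-iso (A ⊸ B)    = ⊸-map-iso (LinIso-sym (θc-iso A)) (θc-iso B)

      θc-iso : ∀ C → LinIso (θc C) (θc⁻¹ C) (C ° °) C
      θc-iso (cconst m) = subst (λ X → LinIso (linId (cconst m)) (linId (cconst m)) X (cconst m))
                            (sym (const°° m)) linId-iso
      θc-iso 𝟙ᶜ         = unitᶜMap-iso
      θc-iso (A & B)    = &-map-iso (θc-iso A) (θc-iso B)
      θc-iso (A ⇛ B)    = ⇛-map-iso (ValIso-sym (θ-iso A)) (θc-iso B)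
      θc-iso Iᶜ         = subst (λ X → LinIso (linId Iᶜ) (linId Iᶜ) X Iᶜ) (sym R°≡I) linId-iso
      θc-iso (! A)      = subst (λ X → LinIso (θc (! A)) (θc⁻¹ (! A)) (A • • !⊗ X) (! A)) (sym R°≡I)
                            (!-iso (θ-iso A))
      θc-iso (A !⊗ B)   = !⊗-map-iso (θ-iso A) (θc-iso B)
      θc-iso 𝟘ᶜ         = linId-iso
      θc-iso (A ⊕ B)    = ⊕-map-iso (θc-iso A) (θc-iso B)

    theta-family : ThetaFamily R θ θ⁻¹ θc θc⁻¹
    theta-family = record
      { θ-const = λ n → refl ; θ-𝟙 = refl ; θ-× = λ A B → refl ; θ-⇒ = λ A B → refl
      ; θ-comp = λ C → refl ; θ-⊸ = λ A B → refl
      ; θc-const = λ n → refl ; θc-𝟙 = refl ; θc-& = λ A B → refl ; θc-⇛ = λ A B → refl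
      ; θc-I = refl ; θc-! = λ A → refl ; θc-!⊗ = λ A B → refl ; θc-𝟘 = refl ; θc-⊕ = λ A B → refl
      ; θ-iso = λ A → ValIso⇒IsIso (θ-iso A)
      ; θc-iso = λ C → LinIso⇒IsLinIso (θc-iso C) }

lemma5p3 : (R : CTy) → ((Σ ℕ λ n → R ≡ cconst n) ⊎ R ≡ Iᶜ)
    → Σ (VTy → Tm) λ θ → Σ (VTy → Tm) λ θ⁻¹
    → Σ (CTy → Tm) λ θc → Σ (CTy → Tm) λ θc⁻¹
    → ThetaFamily R θ θ⁻¹ θc θc⁻¹
lemma5p3 R R-shape = θ , θ⁻¹ , θc , θc⁻¹ , theta-family (involutive R-shape)
  where
  open Theta R
  involutive : ((Σ ℕ λ n → R ≡ cconst n) ⊎ R ≡ Iᶜ) → Involutive R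
  involutive (inj₁ (n , refl)) = const-involutive n
  involutive (inj₂ refl)       = I-involutive
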